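{- Let $E=\{0,1,\dots,n\}$ and let $M$ be a loopless matroid of rank $r+1$ on $E$. Let $F$ be a nonempty proper flat of $M$ and let $v=(v_1,\dots,v_{r-1})$ be a vector of positive integers that is flatly contiguous with respect to $M$. Then $\deg_M(x_F\gamma_{v_1}\cdots\gamma_{v_{r-1}})=0$ unless $\mathrm{rk}(F)=1$ or $\mathrm{rk}(F)=r$.
   Context: The Chow ring $A^*(M)$ (real coefficients) is $\mathbb{R}[x_F : F \text{ a nonempty proper flat of } M]$ modulo the ideal generated by all $x_{F_1}x_{F_2}$ with $F_1,F_2$ incomparable and all $\sum_{F\ni i}x_F-\sum_{F\ni j}x_F$ for $i,j\in E$; $\deg_M:A^r(M)\to\mathbb{R}$ is the linear map with $\deg_M(x_{F_1}\cdots x_{F_r})=1$ for every complete flag of flats $\varnothing\subsetneq F_1\subsetneq\cdots\subsetneq F_r\subsetneq E$. For $S\subseteq E$, $x_S$ means the generator if $S$ is a nonempty proper flat and $0$ otherwise. For $1\le k\le n$ the hypersimplex class is $\gamma_k=\sum_{S}\left(\min(|S|,k)-\frac{k}{n+1}|S|\right)x_S\in A^1(M)$ (sum over nonempty proper $S\subsetneq E$), and $\gamma_k=0$ for $k\le0$ or $k\ge n+1$. The support of $v$ is $\mathrm{Supp}(v)=\{v_1,\dots,v_{r-1}\}$; $v$ is flatly contiguous (with respect to $M$) if there are positive integers $a\le b$ with $\mathrm{Supp}(v)\subseteq\{k: a\le k\le b\}$ such that every flat $G$ of $M$ with $a\le|G|\le b$ satisfies $|G|\in\mathrm{Supp}(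v)$.
   Formalization: The Chow ring $A^*(M)$ has rational instead of real coefficients, and $\deg_M$ takes rational values. -}

module Defs where

open import Data.Nat as ℕ using (ℕ; zero; suc; _≤_; _<_; _⊓_)
open import Data.Bool using (Bool; true; false; if_then_else_; _∨_)
open import Data.Nat using (_≤ᵇ_; _<ᵇ_; _≡ᵇ_)
open import Data.Fin using (Fin)
open import Data.Fin.Subset using (Subset; ⊤; ⁅_⁆; _∈_; _∉_; _⊆_; _⊂_; _∪_; _∩_; ∣_∣; Nonempty)
open import Data.Vec using (Vec; []; _∷_; lookup; toList)
open import Data.List as List using (List; []; _∷_; _++_; length; map; foldr)
open import Data.List.Relation.Unary.All using (All)
open import Data.List.Relation.Unary.Any using (Any)
open import Data.List.Relation.Unary.Linked using (Linked)
open import Data.List.Relation.Binary.Permutation.Propositional using (_↭_)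
open import Data.Integer using (ℤ; +_)
open import Data.Rational using (ℚ; 0ℚ; 1ℚ; _+_; _-_; _*_; _/_)
open import Data.Product using (_×_; Σ; ∃; ∃-syntax)
open import Data.Sum using (_⊎_)
open import Relation.Nullary using (¬_)
open import Relation.Binary.PropositionalEquality using (_≡_; _≢_)

record Matroid (N : ℕ) : Set where
  field
    rk       : Subset N → ℕ
    rk-card  : ∀ A → rk A ≤ ∣ A ∣
    rk-mono  : ∀ {A B} → A ⊆ B → rk A ≤ rk B
    rk-submod : ∀ A B → rk (A ∪ B) ℕ.+ rk (A ∩ B) ≤ rk A ℕ.+ rk B

open Matroid public

Loopless : ∀ {N} → Matroid N → Set
Loopless M = ∀ e → rk M ⁅ e ⁆ ≡ 1

IsFlat : ∀ {N} → Matroid N → Subset N → Set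
IsFlat M F = ∀ e → e ∉ F → rk M F < rk M (F ∪ ⁅ e ⁆)

IsNPFlat : ∀ {N} → Matroid N → Subset N → Set
IsNPFlat M F = IsFlat M F × Nonempty F × F ≢ ⊤

sumℚ : List ℚ → ℚ
sumℚ = foldr _+_ 0ℚ

allSubsets : (N : ℕ) → List (Subset N)
allSubsets zero    = [] ∷ []
allSubsets (suc N) = map (true ∷_) (allSubsets N) ++ map (false ∷_) (allSubsets N)

ΣS : ∀ {N} → (Subset N → ℚ) → ℚ
ΣS {N} f = sumℚ (map f (allSubsets N))

ℕtoℚ : ℕ → ℚ
ℕtoℚ m = (+ m) / 1

-- Degree-r part of the Chow ring, via linear functionals on monomials.
-- A monomial x_{S1}⋯x_{Sk} is a list of subsets; x_S is treated as 0 unless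
-- S is a nonempty proper flat.  A "degree functional" of M (rank r+1) is a
-- ℚ-linear functional on degree-r monomials which vanishes on the degree-r
-- part of the defining ideal of A*(M) and takes the value 1 on every
-- complete flag monomial.  deg_M is the (unique) such functional.

IsCompleteFlag : ∀ {N} → Matroid N → ℕ → List (Subset N) → Set
IsCompleteFlag M r Fs = length Fs ≡ r × All (IsNPFlat M) Fs × Linked _⊂_ Fs

record IsDegFunctional {N} (M : Matroid N) (r : ℕ) (φ : List (Subset N) → ℚ) : Set where
  field
    -- commutativity of the polynomial ring
    symm     : ∀ {m m'} → m ↭ m' → φ m ≡ φ m'
    nonflat  : ∀ m → length m ≡ r → Any (λ S → ¬ IsNPFlat M S) m → φ m ≡ 0ℚ
    incomp   : ∀ F₁ F₂ m → ℕ.suc (ℕ.suc (length m)) ≡ r →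
               IsNPFlat M F₁ → IsNPFlat M F₂ → ¬ (F₁ ⊆ F₂ ⊎ F₂ ⊆ F₁) →
               φ (F₁ ∷ F₂ ∷ m) ≡ 0ℚ
    -- Σ_{F ∋ i} x_F − Σ_{F ∋ j} x_F = 0
    linear   : ∀ (i j : Fin N) m → ℕ.suc (length m) ≡ r →
               ΣS (λ S → if lookup S i then φ (S ∷ m) else 0ℚ)
                 - ΣS (λ S → if lookup S j then φ (S ∷ m) else 0ℚ) ≡ 0ℚ
    flag     : ∀ Fs → IsCompleteFlag M r Fs → φ Fs ≡ 1ℚ

-- Hypersimplex classes γ_k on E = {0,…,n}: coefficient of x_S.

γcoef : (n k : ℕ) → Subset (suc n) → ℚ
γcoef n k S =
  if (k ≤ᵇ 0) ∨ (n <ᵇ k) ∨ (∣ S ∣ ≡ᵇ 0) ∨ (∣ S ∣ ≡ᵇ suc n)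
  then 0ℚ
  else ℕtoℚ (∣ S ∣ ⊓ k) - (+ (k ℕ.* ∣ S ∣)) / suc n

-- φ applied to  m · γ_{k1} ⋯ γ_{kl}  (expanded multilinearly)
φγ : ∀ {n} → (List (Subset (suc n)) → ℚ) → List (Subset (suc n)) → List ℕ → ℚ
φγ φ m []       = φ m
φγ {n} φ m (k ∷ ks) = ΣS (λ S → γcoef n k S * φγ φ (m ++ (S ∷ [])) ks)

Supp : ∀ {l} → Vec ℕ l → List ℕ
Supp v = toList v

FlatlyContiguous : ∀ {N l} → Matroid N → Vec ℕ l → Set
FlatlyContiguous M v =
  ∃[ a ] ∃[ b ] (1 ≤ a × a ≤ b
    × All (λ k → a ≤ k × k ≤ b) (Supp v)
    × (∀ G → IsFlat M G → a ≤ ∣ G ∣ → ∣ G ∣ ≤ b → Data.List.Membership.Propositional._∈_ ∣ G ∣ (Supp v)))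
  where import Data.List.Membership.Propositional

module Submission where

-- Fix i ∈ F and j ∉ F. The linear relations of A*(M) rewrite x_F·γ_k as x_F times a combination of
-- the x_T with T ⊊ F when k ≤ |F| (using i), and with T ⊋ F when k ≥ |F| (using j). Call the entries
-- of v low or high according to a threshold (k ≤ |F|, or k < |F|) and expand: every surviving
-- monomial is x_F times c flats below F and r − 1 − c flats above F, c the number of low entries.
-- Unless c + 1 = rk F, one side contains at least rk B − rk A flats strictly between two flats
-- A ⊂ B of the chain, so by pigeonhole on ranks some flat G is repeated. The linear relation for
-- i ∈ G ∖ D and j ∈ U ∖ G, where D and U are the neighbours of G, trades the repeated x_G for flats
-- of a rank not yet present, and induction on the number of missing ranks kills the monomial.
-- Flat contiguity makes one threshold miss rk F: if a ≤ |F| ≤ b then |F| occurs in v and the two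
-- counts differ; if |F| < a then c = 0, so rk F = 1; if |F| > b then c = r − 1, so rk F = r.

open import Defs
open import Data.Nat using (ℕ; suc; _∸_; _≤_)
open import Data.Fin.Subset using (Subset; ⊤)
open import Data.Vec using (Vec; toList)
open import Data.List using (List; []; _∷_)
open import Data.List.Relation.Unary.All using (All)
open import Data.Rational using (ℚ; 0ℚ)
open import Relation.Binary.PropositionalEquality using (_≡_; _≢_)

open import Data.Bool using (Bool; true; false; if_then_else_)
import Data.Bool as Bool
import Data.Bool.Properties as Bool
open import Data.Fin using (Fin; zero; suc)
open import Data.Fin.Properties using (all?; ¬∀⟶∃¬)
open import Data.Fin.Subset using (∣_∣; _∈_; _∉_; _⊆_; _⊂_; _∪_; _∩_; ⁅_⁆; Nonempty) renaming (⊥ to ∅)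
open import Data.Fin.Subset.Properties renaming (⊥⊆ to ∅⊆)
  using (_⊆?_; _⊂?_; _∈?_; nonempty?; ⊆-refl; ⊆-trans; ⊆-antisym; ⊂-trans; ⊆-⊂-trans; ⊂-⊆-trans; p⊆q⇒∣p∣≤∣q∣;
         ⊆⊤; ∈⊤; ∉⊥; p∩q⊆p; x∈p∩q⁺; x∈p∪q⁻; x∈⁅y⁆⇒x≡y; ∣⊥∣≡0; ∣⊤∣≡n; ∪-identityˡ; ∩-identityʳ)
import Data.Integer as ℤ
import Data.Integer.Properties as ℤ
open import Data.Integer.Solver using (module +-*-Solver)
open import Data.List using (_++_; map; length; allFin; filter; upTo)
open import Data.List.Properties
  using (map-tabulate; length-++; length-map; ++-assoc; ++-identityʳ; filter-all; filter-none; filter-accept; filter-reject)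
open import Data.List.Membership.Propositional using (find; lose) renaming (_∈_ to _∈ₗ_)
open import Data.List.Membership.Propositional.Properties using (∈-∃++; ∈-upTo⁺; ∈-++⁺ˡ; ∈-++⁺ʳ)
open import Data.List.Relation.Binary.Permutation.Propositional using (_↭_; ↭-refl; ↭-sym; ↭-trans; prep; swap)
open import Data.List.Relation.Binary.Permutation.Propositional.Properties
  using (shift; ∷↭∷ʳ; ++⁺ʳ; ++-comm; ↭-length; ∈-resp-↭; All-resp-↭; Any-resp-↭)
open import Data.List.Relation.Binary.Pointwise using (Pointwise; []; _∷_; Pointwise-length)
open import Data.List.Relation.Unary.All using ([]; _∷_)
import Data.List.Relation.Unary.All as All
open import Data.List.Relation.Unary.All.Properties using (¬All⇒Any¬; ¬Any⇒All¬) renaming (++⁻ to All++⁻)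
open import Data.List.Relation.Unary.Any using (Any; any?; here; there)
import Data.Nat as ℕ
open import Data.Nat using (zero; _<_; _≤?_; _<?_)
import Data.Nat.Properties as ℕ
open import Data.Product using (∃; _×_; _,_; proj₁; proj₂)
open import Data.Rational using (1ℚ; _+_; _-_; _*_; _/_; toℚᵘ)
open import Data.Rational.Properties
  using (+-0-group; +-inverseʳ; +-identityʳ; +-identityˡ; +-assoc; *-comm; *-assoc; *-zeroʳ; *-zeroˡ; *-identityˡ;
         *-distribˡ-+; *-distribʳ-+; toℚᵘ-injective; toℚᵘ-fromℚᵘ; toℚᵘ-homo-+; toℚᵘ-homo-*)
open import Algebra.Properties.Group +-0-group using (x∙y⁻¹≈ε⇒x≈y)
open import Data.Rational.Solver using () renaming (module +-*-Solver to ℚ-Solver)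
import Data.Rational.Unnormalised as ℚᵘ
import Data.Rational.Unnormalised.Properties as ℚᵘ
open import Data.Sum using (_⊎_; inj₁; inj₂; [_,_])
open import Data.Vec using ([]; _∷_; lookup)
open import Data.Vec.Properties using (length-toList; ∷-injectiveʳ; lookup⇒[]=; []=⇒lookup; ≡-dec; lookup-zipWith)
open import Function using (_∘_; Equivalence)
open import Relation.Binary.Definitions using (tri<; tri≈; tri>)
open import Relation.Binary.PropositionalEquality using (refl; sym; trans; cong; cong₂; subst; subst₂; module ≡-Reasoning)
open import Relation.Nullary using (¬_; Dec; does; yes; no; contradiction)
open import Relation.Nullary.Decidable using (_⊎-dec_; _×-dec_; _→-dec_; ¬?)

toℚᵘ-ℕ/ : ∀ a d → toℚᵘ ((ℤ.+ a) / suc d) ℚᵘ.≃ ℚᵘ.mkℚᵘ (ℤ.+ a) d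
toℚᵘ-ℕ/ a d = toℚᵘ-fromℚᵘ (ℚᵘ.mkℚᵘ (ℤ.+ a) d)

ℕtoℚ-+ : ∀ a b → ℕtoℚ (a ℕ.+ b) ≡ ℕtoℚ a + ℕtoℚ b
ℕtoℚ-+ a b = toℚᵘ-injective (begin
  toℚᵘ (ℕtoℚ (a ℕ.+ b))                        ≈⟨ toℚᵘ-ℕ/ (a ℕ.+ b) 0 ⟩
  ℚᵘ.mkℚᵘ (ℤ.+ (a ℕ.+ b)) 0                    ≈⟨ ℚᵘ.*≡* eq ⟩
  ℚᵘ.mkℚᵘ (ℤ.+ a) 0 ℚᵘ.+ ℚᵘ.mkℚᵘ (ℤ.+ b) 0     ≈⟨ ℚᵘ.+-cong (toℚᵘ-ℕ/ a 0) (toℚᵘ-ℕ/ b 0) ⟨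
  toℚᵘ (ℕtoℚ a) ℚᵘ.+ toℚᵘ (ℕtoℚ b)             ≈⟨ toℚᵘ-homo-+ (ℕtoℚ a) (ℕtoℚ b) ⟨
  toℚᵘ (ℕtoℚ a + ℕtoℚ b)                       ∎)
  where
  open ℚᵘ.≃-Reasoning
  open +-*-Solver
  eq : ℤ.+ (a ℕ.+ b) ℤ.* ℤ.+ 1 ≡ (ℤ.+ a ℤ.* ℤ.+ 1 ℤ.+ ℤ.+ b ℤ.* ℤ.+ 1) ℤ.* ℤ.+ 1
  eq = trans (cong (ℤ._* ℤ.+ 1) (ℤ.pos-+ a b))
         (solve 2 (λ x y → (x :+ y) :* con (ℤ.+ 1) := (x :* con (ℤ.+ 1) :+ y :* con (ℤ.+ 1)) :* con (ℤ.+ 1)) refl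
                (ℤ.+ a) (ℤ.+ b))

[k*s]/N≡[k/N]*s : ∀ k s n → (ℤ.+ (k ℕ.* s)) / suc n ≡ ((ℤ.+ k) / suc n) * ℕtoℚ s
[k*s]/N≡[k/N]*s k s n = toℚᵘ-injective (begin
  toℚᵘ ((ℤ.+ (k ℕ.* s)) / suc n)                  ≈⟨ toℚᵘ-ℕ/ (k ℕ.* s) n ⟩
  ℚᵘ.mkℚᵘ (ℤ.+ (k ℕ.* s)) n                       ≈⟨ ℚᵘ.*≡* eq ⟩
  ℚᵘ.mkℚᵘ (ℤ.+ k) n ℚᵘ.* ℚᵘ.mkℚᵘ (ℤ.+ s) 0          ≈⟨ ℚᵘ.*-cong (toℚᵘ-ℕ/ k n) (toℚᵘ-ℕ/ s 0) ⟨
  toℚᵘ ((ℤ.+ k) / suc n) ℚᵘ.* toℚᵘ (ℕtoℚ s)      ≈⟨ toℚᵘ-homo-* ((ℤ.+ k) / suc n) (ℕtoℚ s) ⟨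
  toℚᵘ (((ℤ.+ k) / suc n) * ℕtoℚ s)               ∎)
  where
  open ℚᵘ.≃-Reasoning
  open +-*-Solver
  eq : ℤ.+ (k ℕ.* s) ℤ.* (ℤ.+ suc n ℤ.* ℤ.+ 1) ≡ (ℤ.+ k ℤ.* ℤ.+ s) ℤ.* ℤ.+ suc n
  eq = trans (cong (ℤ._* (ℤ.+ suc n ℤ.* ℤ.+ 1)) (ℤ.pos-* k s))
         (solve 3 (λ x y z → (x :* y) :* (z :* con (ℤ.+ 1)) := (x :* y) :* z) refl (ℤ.+ k) (ℤ.+ s) (ℤ.+ suc n))

[k/N]*N≡k : ∀ k n → ((ℤ.+ k) / suc n) * ℕtoℚ (suc n) ≡ ℕtoℚ k
[k/N]*N≡k k n = toℚᵘ-injective (begin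
  toℚᵘ (((ℤ.+ k) / suc n) * ℕtoℚ (suc n))             ≈⟨ toℚᵘ-homo-* ((ℤ.+ k) / suc n) (ℕtoℚ (suc n)) ⟩
  toℚᵘ ((ℤ.+ k) / suc n) ℚᵘ.* toℚᵘ (ℕtoℚ (suc n))   ≈⟨ ℚᵘ.*-cong (toℚᵘ-ℕ/ k n) (toℚᵘ-ℕ/ (suc n) 0) ⟩
  ℚᵘ.mkℚᵘ (ℤ.+ k) n ℚᵘ.* ℚᵘ.mkℚᵘ (ℤ.+ suc n) 0         ≈⟨ ℚᵘ.*≡* (ℤ.*-assoc (ℤ.+ k) (ℤ.+ suc n) (ℤ.+ 1)) ⟩
  ℚᵘ.mkℚᵘ (ℤ.+ k) 0                                   ≈⟨ toℚᵘ-ℕ/ k 0 ⟨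
  toℚᵘ (ℕtoℚ k)                                     ∎)
  where open ℚᵘ.≃-Reasoning

private variable A B : Set

sumOver : List A → (A → ℚ) → ℚ
sumOver xs f = sumℚ (map f xs)

sumOver-cong : ∀ (xs : List A) {f g : A → ℚ} → (∀ x → f x ≡ g x) → sumOver xs f ≡ sumOver xs g
sumOver-cong []       f≡g = refl
sumOver-cong (x ∷ xs) f≡g = cong₂ _+_ (f≡g x) (sumOver-cong xs f≡g)

sumOver-zero : ∀ (xs : List A) {f : A → ℚ} → (∀ x → f x ≡ 0ℚ) → sumOver xs f ≡ 0ℚ
sumOver-zero []       f≡0 = refl
sumOver-zero (x ∷ xs) f≡0 = cong₂ _+_ (f≡0 x) (sumOver-zero xs f≡0)

sumOver-+ : ∀ (xs : List A) (f g : A → ℚ) → sumOver xs (λ x → f x + g x) ≡ sumOver xs f + sumOver xs g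
sumOver-+ []       f g = refl
sumOver-+ (x ∷ xs) f g = trans (cong ((f x + g x) +_) (sumOver-+ xs f g))
  (solve 4 (λ a b c d → a :+ b :+ (c :+ d) := a :+ c :+ (b :+ d)) refl (f x) (g x) (sumOver xs f) (sumOver xs g))
  where open ℚ-Solver

sumOver-- : ∀ (xs : List A) (f g : A → ℚ) → sumOver xs (λ x → f x - g x) ≡ sumOver xs f - sumOver xs g
sumOver-- []       f g = refl
sumOver-- (x ∷ xs) f g = trans (cong ((f x - g x) +_) (sumOver-- xs f g))
  (solve 4 (λ a b c d → a :- b :+ (c :- d) := a :+ c :- (b :+ d)) refl (f x) (g x) (sumOver xs f) (sumOver xs g))
  where open ℚ-Solver

sumOver-*ˡ : ∀ (xs : List A) (c : ℚ) (f : A → ℚ) → sumOver xs (λ x → c * f x) ≡ c * sumOver xs f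
sumOver-*ˡ []       c f = sym (*-zeroʳ c)
sumOver-*ˡ (x ∷ xs) c f = trans (cong (c * f x +_) (sumOver-*ˡ xs c f)) (sym (*-distribˡ-+ c (f x) (sumOver xs f)))

sumOver-++ : ∀ (xs ys : List A) (f : A → ℚ) → sumOver (xs ++ ys) f ≡ sumOver xs f + sumOver ys f
sumOver-++ []       ys f = sym (+-identityˡ _)
sumOver-++ (x ∷ xs) ys f = trans (cong (f x +_) (sumOver-++ xs ys f)) (sym (+-assoc (f x) _ _))

sumOver-map : (g : A → B) (xs : List A) (f : B → ℚ) → sumOver (map g xs) f ≡ sumOver xs (f ∘ g)
sumOver-map g []       f = refl
sumOver-map g (x ∷ xs) f = cong (f (g x) +_) (sumOver-map g xs f)

sumOver-comm : (xs : List A) (ys : List B) (h : A → B → ℚ) →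
  sumOver xs (λ x → sumOver ys (h x)) ≡ sumOver ys (λ y → sumOver xs (λ x → h x y))
sumOver-comm []       ys h = sym (sumOver-zero ys (λ _ → refl))
sumOver-comm (x ∷ xs) ys h = trans (cong (sumOver ys (h x) +_) (sumOver-comm xs ys h))
  (sym (sumOver-+ ys (h x) (λ y → sumOver xs (λ x′ → h x′ y))))

ΣS-suc : ∀ {N} (h : Subset (suc N) → ℚ) → ΣS h ≡ ΣS (h ∘ (true ∷_)) + ΣS (h ∘ (false ∷_))
ΣS-suc {N} h = begin
  sumOver (map (true ∷_) (allSubsets N) ++ map (false ∷_) (allSubsets N)) h
    ≡⟨ sumOver-++ (map (true ∷_) (allSubsets N)) _ h ⟩
  sumOver (map (true ∷_) (allSubsets N)) h + sumOver (map (false ∷_) (allSubsets N)) h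
    ≡⟨ cong₂ _+_ (sumOver-map (true ∷_) (allSubsets N) h) (sumOver-map (false ∷_) (allSubsets N) h) ⟩
  ΣS (h ∘ (true ∷_)) + ΣS (h ∘ (false ∷_)) ∎
  where open ≡-Reasoning

ΣS-zero : ∀ {N} {h : Subset N → ℚ} → (∀ S → h S ≡ 0ℚ) → ΣS h ≡ 0ℚ
ΣS-zero {N} = sumOver-zero (allSubsets N)

ΣS-cong : ∀ {N} {g h : Subset N → ℚ} → (∀ S → g S ≡ h S) → ΣS g ≡ ΣS h
ΣS-cong {N} = sumOver-cong (allSubsets N)

ΣS-concentrated : ∀ {N} (G : Subset N) (h : Subset N → ℚ) → (∀ S → S ≢ G → h S ≡ 0ℚ) → ΣS h ≡ h G
ΣS-concentrated {zero}  []        h _   = +-identityʳ (h [])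
ΣS-concentrated {suc N} (true ∷ G)  h off = begin
  ΣS h                                       ≡⟨ ΣS-suc h ⟩
  ΣS (h ∘ (true ∷_)) + ΣS (h ∘ (false ∷_))   ≡⟨ cong₂ _+_ (ΣS-concentrated G _ (λ S S≢G → off _ (S≢G ∘ ∷-injectiveʳ)))
                                                          (ΣS-zero (λ S → off (false ∷ S) (λ ()))) ⟩
  h (true ∷ G) + 0ℚ                          ≡⟨ +-identityʳ _ ⟩
  h (true ∷ G)                               ∎
  where open ≡-Reasoning
ΣS-concentrated {suc N} (false ∷ G) h off = begin
  ΣS h                                       ≡⟨ ΣS-suc h ⟩
  ΣS (h ∘ (true ∷_)) + ΣS (h ∘ (false ∷_))   ≡⟨ cong₂ _+_
                                                   (ΣS-zero (λ S → off (true ∷ S) (λ ())))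
                                                   (ΣS-concentrated G _ (λ S S≢G → off (false ∷ S) (S≢G ∘ ∷-injectiveʳ))) ⟩
  0ℚ + h (false ∷ G)                         ≡⟨ +-identityˡ _ ⟩
  h (false ∷ G)                              ∎
  where open ≡-Reasoning

ΣS-exchange : ∀ {N} (c d : Subset N → ℚ) (g : Subset N → Subset N → ℚ) →
  ΣS (λ T → c T * ΣS (λ S → d S * g T S)) ≡ ΣS (λ S → d S * ΣS (λ T → c T * g T S))
ΣS-exchange {N} c d g = begin
  ΣS (λ T → c T * ΣS (λ S → d S * g T S))   ≡⟨ ΣS-cong (λ T → sym (sumOver-*ˡ (allSubsets N) (c T) _)) ⟩
  ΣS (λ T → ΣS (λ S → c T * (d S * g T S)))  ≡⟨ sumOver-comm (allSubsets N) (allSubsets N) _ ⟩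
  ΣS (λ S → ΣS (λ T → c T * (d S * g T S)))  ≡⟨ ΣS-cong (λ S → ΣS-cong (λ T → *-left-comm (c T) (d S) (g T S))) ⟩
  ΣS (λ S → ΣS (λ T → d S * (c T * g T S)))  ≡⟨ ΣS-cong (λ S → sumOver-*ˡ (allSubsets N) (d S) _) ⟩
  ΣS (λ S → d S * ΣS (λ T → c T * g T S))    ∎
  where
  open ≡-Reasoning
  *-left-comm : ∀ a b x → a * (b * x) ≡ b * (a * x)
  *-left-comm = solve 3 (λ a b x → a :* (b :* x) := b :* (a :* x)) refl
    where open ℚ-Solver

𝟙 : Bool → ℚ
𝟙 b = if b then 1ℚ else 0ℚ

𝟙-* : ∀ b x → 𝟙 b * x ≡ (if b then x else 0ℚ)
𝟙-* true  x = *-identityˡ x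
𝟙-* false x = *-zeroˡ x

if-difference≡0 : ∀ a b (x : ℚ) → (a ≡ true → b ≡ false → x ≡ 0ℚ) → (a ≡ false → b ≡ true → x ≡ 0ℚ) →
  (if a then x else 0ℚ) - (if b then x else 0ℚ) ≡ 0ℚ
if-difference≡0 true  true  x _  _  = +-inverseʳ x
if-difference≡0 true  false x tf _  = trans (+-identityʳ x) (tf refl refl)
if-difference≡0 false true  x _  ft = cong (λ y → 0ℚ - y) (ft refl refl)
if-difference≡0 false false x _  _  = refl

sumOver-allFin-suc : ∀ {N} (g : Fin (suc N) → ℚ) →
  sumOver (allFin (suc N)) g ≡ g zero + sumOver (allFin N) (g ∘ suc)
sumOver-allFin-suc {N} g = cong (g zero +_) (trans (cong (λ xs → sumOver xs g) (sym (map-tabulate (λ e → e) suc)))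
                                                   (sumOver-map suc (allFin N) g))

ℕtoℚ∣S∣≡Σ𝟙 : ∀ {N} (S : Subset N) → ℕtoℚ ∣ S ∣ ≡ sumOver (allFin N) (λ e → 𝟙 (lookup S e))
ℕtoℚ∣S∣≡Σ𝟙 []          = refl
ℕtoℚ∣S∣≡Σ𝟙 (true ∷ S)  = trans (ℕtoℚ-+ 1 ∣ S ∣) (trans (cong (1ℚ +_) (ℕtoℚ∣S∣≡Σ𝟙 S))
                                                      (sym (sumOver-allFin-suc (λ e → 𝟙 (lookup (true ∷ S) e)))))
ℕtoℚ∣S∣≡Σ𝟙 (false ∷ S) = trans (ℕtoℚ∣S∣≡Σ𝟙 S) (trans (sym (+-identityˡ _))
                                                      (sym (sumOver-allFin-suc (λ e → 𝟙 (lookup (false ∷ S) e)))))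

∈⇒↭∷ : ∀ {x : A} {xs} → x ∈ₗ xs → ∃ λ ys → xs ↭ x ∷ ys
∈⇒↭∷ {x = x} x∈xs with ys , zs , refl ← ∈-∃++ x∈xs = ys ++ zs , shift x ys zs

length-∷ʳ-+ : ∀ (m : List A) x k → length (m ++ x ∷ []) ℕ.+ k ≡ length m ℕ.+ suc k
length-∷ʳ-+ []      x k = refl
length-∷ʳ-+ (y ∷ m) x k = cong suc (length-∷ʳ-+ m x k)

length-filter-mono : ∀ {P Q : A → Set} (P? : ∀ x → Dec (P x)) (Q? : ∀ x → Dec (Q x)) → (∀ {x} → Q x → P x) →
  ∀ xs → length (filter Q? xs) ≤ length (filter P? xs)
length-filter-mono P? Q? Q⇒P []       = ℕ.z≤n
length-filter-mono P? Q? Q⇒P (x ∷ xs) with P? x | Q? x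
... | yes _ | yes _ = ℕ.s≤s (length-filter-mono P? Q? Q⇒P xs)
... | yes _ | no _  = ℕ.m≤n⇒m≤1+n (length-filter-mono P? Q? Q⇒P xs)
... | no ¬p | yes q = contradiction (Q⇒P q) ¬p
... | no _  | no _  = length-filter-mono P? Q? Q⇒P xs

length-filter-mono-< : ∀ {P Q : A → Set} (P? : ∀ x → Dec (P x)) (Q? : ∀ x → Dec (Q x)) → (∀ {x} → Q x → P x) →
  ∀ {xs} → Any (λ x → P x × ¬ Q x) xs → length (filter Q? xs) < length (filter P? xs)
length-filter-mono-< P? Q? Q⇒P {x ∷ xs} x∈P∖Q with P? x | Q? x | x∈P∖Q
... | _     | yes q | here (_ , ¬q) = contradiction q ¬q
... | no ¬p | _     | here (p , _)  = contradiction p ¬p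
... | yes _ | no _  | here _        = ℕ.s≤s (length-filter-mono P? Q? Q⇒P xs)
... | yes _ | yes _ | there rest    = ℕ.s≤s (length-filter-mono-< P? Q? Q⇒P rest)
... | yes _ | no _  | there rest    = ℕ.m≤n⇒m≤1+n (length-filter-mono-< P? Q? Q⇒P rest)
... | no ¬p | yes q | there rest    = contradiction (Q⇒P q) ¬p
... | no _  | no _  | there rest    = length-filter-mono-< P? Q? Q⇒P rest

threshold-count-misses : ∀ {a b f p} ks → All (λ k → a ≤ k × k ≤ b) ks → (a ≤ f → f ≤ b → f ∈ₗ ks) →
  p ≢ 1 → p ≢ suc (length ks) →
  suc (length (filter (_≤? f) ks)) ≢ p ⊎ suc (length (filter (_<? f) ks)) ≢ p
threshold-count-misses {a} {b} {f} {p} ks in-range contiguous p≢1 p≢1+len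
  with suc (length (filter (_≤? f) ks)) ℕ.≟ p | suc (length (filter (_<? f) ks)) ℕ.≟ p
... | no ≤-misses | _           = inj₁ ≤-misses
... | yes _       | no <-misses = inj₂ <-misses
... | yes ≤-hits  | yes <-hits with a ℕ.≤? f | f ℕ.≤? b
...   | yes a≤f | yes f≤b = contradiction (trans <-hits (sym ≤-hits))
        (ℕ.<⇒≢ (ℕ.s≤s (length-filter-mono-< (_≤? f) (_<? f) ℕ.<⇒≤ (lose (contiguous a≤f f≤b) (ℕ.≤-refl , ℕ.<-irrefl refl)))))
...   | no a≰f  | _       = contradiction (trans (sym ≤-hits) (cong (λ l → suc (length l))
        (filter-none (_≤? f) (All.map (λ { (a≤k , _) k≤f → a≰f (ℕ.≤-trans a≤k k≤f) }) in-range)))) p≢1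
...   | yes _   | no f≰b  = contradiction (trans (sym <-hits) (cong (λ l → suc (length l))
        (filter-all (_<? f) (All.map (λ { (_ , k≤b) → ℕ.≤-<-trans k≤b (ℕ.≰⇒> f≰b) }) in-range)))) p≢1+len

module _ (g : A → ℕ) where

  bounds-tighten : ∀ {lo h} xs → All (λ x → lo ≤ g x × g x < suc h) xs → ¬ Any (λ x → g x ≡ h) xs →
    All (λ x → lo ≤ g x × g x < h) xs
  bounds-tighten xs bounds ¬≡h = All.zipWith
    (λ { ((lo≤gx , gx<1+h) , gx≢h) → lo≤gx , ℕ.≤∧≢⇒< (ℕ.s≤s⁻¹ gx<1+h) gx≢h }) (bounds , ¬Any⇒All¬ xs ¬≡h)

  pigeonhole : ∀ {lo} hi xs → All (λ x → lo ≤ g x × g x < hi) xs → hi ∸ lo < length xs →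
    ∃ λ x → ∃ λ y → ∃ λ zs → xs ↭ x ∷ y ∷ zs × g x ≡ g y
  pigeonhole zero [] _ ()
  pigeonhole zero (x ∷ xs) ((_ , ()) ∷ _) _
  pigeonhole {lo} (suc h) xs bounds count with any? (λ x → g x ℕ.≟ h) xs
  ... | no none =
    pigeonhole h xs (bounds-tighten xs bounds none) (ℕ.≤-<-trans (ℕ.∸-monoˡ-≤ lo (ℕ.n≤1+n h)) count)
  ... | yes some with find some
  ...   | x , x∈xs , gx≡h with ∈⇒↭∷ x∈xs
  ...     | xs′ , xs↭x∷xs′ with any? (λ y → g y ℕ.≟ h) xs′
  ...       | yes again with find again
  ...         | y , y∈xs′ , gy≡h with ∈⇒↭∷ y∈xs′
  ...           | ys , xs′↭y∷ys = x , y , ys , ↭-trans xs↭x∷xs′ (prep x xs′↭y∷ys) , trans gx≡h (sym gy≡h)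
  pigeonhole {lo} (suc h) xs bounds count | yes _ | x , x∈xs , gx≡h | xs′ , xs↭x∷xs′ | no none
    with pigeonhole h xs′ (bounds-tighten xs′ (All.tail (All-resp-↭ xs↭x∷xs′ bounds)) none) count′
    where
    lo≤h : lo ≤ h
    lo≤h = subst (lo ≤_) gx≡h (proj₁ (All.lookup bounds x∈xs))
    count′ : h ∸ lo < length xs′
    count′ = ℕ.s≤s⁻¹ (subst₂ _<_ (ℕ.+-∸-assoc 1 lo≤h) (↭-length xs↭x∷xs′) count)
  ... | a , b , zs , xs′↭a∷b∷zs , ga≡gb =
    a , b , x ∷ zs , ↭-trans xs↭x∷xs′ (↭-trans (prep x xs′↭a∷b∷zs) (↭-trans (swap x a ↭-refl) (prep a (swap x b ↭-refl))))
    , ga≡gb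

  missingBelow : ℕ → List A → ℕ
  missingBelow h xs = length (filter (λ t → ¬? (any? (λ x → g x ℕ.≟ t) xs)) (upTo h))

  missingBelow-< : ∀ {h} xs ys → (∀ {t} → Any (λ x → g x ≡ t) xs → Any (λ y → g y ≡ t) ys) →
    ∀ {t} → t < h → Any (λ y → g y ≡ t) ys → ¬ Any (λ x → g x ≡ t) xs → missingBelow h ys < missingBelow h xs
  missingBelow-< xs ys xs⊑ys t<h ys∋t xs∌t =
    length-filter-mono-< _ _ (λ ys∌t xs∋t → ys∌t (xs⊑ys xs∋t)) (lose (∈-upTo⁺ t<h) (xs∌t , λ ys∌t → ys∌t ys∋t))

Comparable : ∀ {N} → Subset N → Subset N → Set
Comparable X Y = X ⊆ Y ⊎ Y ⊆ X

comparable? : ∀ {N} (X Y : Subset N) → Dec (Comparable X Y)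
comparable? X Y = (X ⊆? Y) ⊎-dec (Y ⊆? X)

⊆⇒≡⊎⊂ : ∀ {N} {X Y : Subset N} → X ⊆ Y → X ≡ Y ⊎ X ⊂ Y
⊆⇒≡⊎⊂ {X = X} {Y} X⊆Y with X ⊂? Y
... | yes X⊂Y = inj₂ X⊂Y
... | no  X⊄Y = inj₁ (⊆-antisym X⊆Y Y⊆X)
  where
  Y⊆X : Y ⊆ X
  Y⊆X {x} x∈Y with x ∈? X
  ... | yes x∈X = x∈X
  ... | no  x∉X = contradiction ((λ {z} → X⊆Y {z}) , x , x∈Y , x∉X) X⊄Y

≢⊤⇒∃∉ : ∀ {N} {X : Subset N} → X ≢ ⊤ → ∃ λ x → x ∉ X
≢⊤⇒∃∉ {N} {X} X≢⊤ with all? (_∈? X)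
... | yes all∈ = contradiction (⊆-antisym ⊆⊤ (λ {x} _ → all∈ x)) X≢⊤
... | no ¬all∈ = ¬∀⟶∃¬ N (_∈ X) (_∈? X) ¬all∈

nonempty⇒∅⊂ : ∀ {N} {X : Subset N} → Nonempty X → ∅ ⊂ X
nonempty⇒∅⊂ (x , x∈X) = ∅⊆ , x , x∈X , ∉⊥

≢⊤⇒⊂⊤ : ∀ {N} {X : Subset N} → X ≢ ⊤ → X ⊂ ⊤
≢⊤⇒⊂⊤ X≢⊤ = let x , x∉X = ≢⊤⇒∃∉ X≢⊤ in ⊆⊤ , x , ∈⊤ , x∉X

⊆⇒∩≡ : ∀ {N} {X Y : Subset N} → X ⊆ Y → X ∩ Y ≡ X
⊆⇒∩≡ {X = X} {Y} X⊆Y = ⊆-antisym (p∩q⊆p X Y) (λ x∈X → x∈p∩q⁺ (x∈X , X⊆Y x∈X))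

∉⇒lookup≡false : ∀ {N} {x : Fin N} (X : Subset N) → x ∉ X → lookup X x ≡ false
∉⇒lookup≡false {x = x} X x∉X with lookup X x in eq
... | true  = contradiction (lookup⇒[]= x X eq) x∉X
... | false = refl

lookup≡false⇒∉ : ∀ {N} {x : Fin N} {X : Subset N} → lookup X x ≡ false → x ∉ X
lookup≡false⇒∉ X[x]≡false x∈X with () ← trans (sym ([]=⇒lookup x∈X)) X[x]≡false

IsChain : ∀ {N} → List (Subset N) → Set
IsChain L = All (λ X → All (Comparable X) L) L

ends-map : ∀ {N} {L L′ : List (Subset N)} → (∀ {X} → X ∈ₗ L → X ∈ₗ L′) → ∀ {X} → X ∈ₗ ∅ ∷ ⊤ ∷ L → X ∈ₗ ∅ ∷ ⊤ ∷ L′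
ends-map L⊆L′ (here X≡∅)          = here X≡∅
ends-map L⊆L′ (there (here X≡⊤))  = there (here X≡⊤)
ends-map L⊆L′ (there (there X∈L)) = there (there (L⊆L′ X∈L))

chain-comparable : ∀ {N} {L : List (Subset N)} {X Y} → IsChain L → X ∈ₗ L → Y ∈ₗ ∅ ∷ ⊤ ∷ L → Comparable X Y
chain-comparable chain X∈L (here refl)         = inj₂ ∅⊆
chain-comparable chain X∈L (there (here refl)) = inj₁ ⊆⊤
chain-comparable chain X∈L (there (there Y∈L)) = All.lookup (All.lookup chain X∈L) Y∈L

module _ {N} {L : List (Subset N)} (chain : IsChain L) where

  greatest-below : ∀ {G A} Xs → (∀ {X} → X ∈ₗ Xs → X ∈ₗ L) → G ∈ₗ L → A ∈ₗ ∅ ∷ ⊤ ∷ L → A ⊂ G →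
    ∃ λ D → A ⊆ D × D ⊂ G × D ∈ₗ ∅ ∷ ⊤ ∷ L × All (λ X → X ⊆ D ⊎ G ⊆ X) Xs
  greatest-below []       _     _   A∈ A⊂G = _ , (λ x∈A → x∈A) , A⊂G , A∈ , []
  greatest-below (X ∷ Xs) Xs⊆L G∈L A∈ A⊂G
    with greatest-below Xs (Xs⊆L ∘ there) G∈L A∈ A⊂G | chain-comparable chain (Xs⊆L (here refl)) (there (there G∈L))
  ... | D , A⊆D , D⊂G , D∈ , sides | inj₂ G⊆X = D , A⊆D , D⊂G , D∈ , inj₂ G⊆X ∷ sides
  ... | D , A⊆D , D⊂G , D∈ , sides | inj₁ X⊆G with chain-comparable chain (Xs⊆L (here refl)) D∈ | ⊆⇒≡⊎⊂ X⊆G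
  ...   | inj₁ X⊆D | _         = D , A⊆D , D⊂G , D∈ , inj₁ X⊆D ∷ sides
  ...   | inj₂ _   | inj₁ refl = D , A⊆D , D⊂G , D∈ , inj₂ (λ x∈X → x∈X) ∷ sides
  ...   | inj₂ D⊆X | inj₂ X⊂G  = X , ⊆-trans A⊆D D⊆X , X⊂G , there (there (Xs⊆L (here refl))) ,
                                 inj₁ (λ x∈X → x∈X) ∷ All.map (λ { (inj₁ Y⊆D) → inj₁ (λ {x} → ⊆-trans Y⊆D D⊆X {x})
                                                                 ; (inj₂ G⊆Y) → inj₂ (λ {x} → G⊆Y {x}) }) sides

  least-above : ∀ {G B} Xs → (∀ {X} → X ∈ₗ Xs → X ∈ₗ L) → G ∈ₗ L → B ∈ₗ ∅ ∷ ⊤ ∷ L → G ⊂ B →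
    ∃ λ U → U ⊆ B × G ⊂ U × U ∈ₗ ∅ ∷ ⊤ ∷ L × All (λ X → X ⊆ G ⊎ U ⊆ X) Xs
  least-above []       _     _   B∈ G⊂B = _ , (λ x∈B → x∈B) , G⊂B , B∈ , []
  least-above (X ∷ Xs) Xs⊆L G∈L B∈ G⊂B
    with least-above Xs (Xs⊆L ∘ there) G∈L B∈ G⊂B | chain-comparable chain (Xs⊆L (here refl)) (there (there G∈L))
  ... | U , U⊆B , G⊂U , U∈ , sides | inj₁ X⊆G = U , U⊆B , G⊂U , U∈ , inj₁ X⊆G ∷ sides
  ... | U , U⊆B , G⊂U , U∈ , sides | inj₂ G⊆X with chain-comparable chain (Xs⊆L (here refl)) U∈ | ⊆⇒≡⊎⊂ G⊆X
  ...   | inj₂ U⊆X | _         = U , U⊆B , G⊂U , U∈ , inj₂ U⊆X ∷ sides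
  ...   | inj₁ _   | inj₁ refl = U , U⊆B , G⊂U , U∈ , inj₁ (λ x∈X → x∈X) ∷ sides
  ...   | inj₁ X⊆U | inj₂ G⊂X  = X , ⊆-trans X⊆U U⊆B , G⊂X , there (there (Xs⊆L (here refl))) ,
                                 inj₂ (λ x∈X → x∈X) ∷ All.map (λ { (inj₁ Y⊆G) → inj₁ (λ {x} → Y⊆G {x})
                                                                 ; (inj₂ U⊆Y) → inj₂ (λ {x} → ⊆-trans X⊆U U⊆Y {x}) }) sides

module _ {N} (M : Matroid N) where

  flat-⊂⇒rk< : ∀ {X Y} → IsFlat M X → X ⊂ Y → rk M X < rk M Y
  flat-⊂⇒rk< {X} {Y} X-flat (X⊆Y , y , y∈Y , y∉X) = ℕ.<-≤-trans (X-flat y y∉X) (rk-mono M X∪y⊆Y)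
    where
    X∪y⊆Y : X ∪ ⁅ y ⁆ ⊆ Y
    X∪y⊆Y x∈X∪y with x∈p∪q⁻ X ⁅ y ⁆ x∈X∪y
    ... | inj₁ x∈X = X⊆Y x∈X
    ... | inj₂ x∈y = subst (_∈ Y) (sym (x∈⁅y⁆⇒x≡y y x∈y)) y∈Y

  rk-∅ : rk M ∅ ≡ 0
  rk-∅ = ℕ.n≤0⇒n≡0 (subst (rk M ∅ ≤_) (∣⊥∣≡0 N) (rk-card M ∅))

  ∅-isFlat : Loopless M → IsFlat M ∅
  ∅-isFlat loopless e _ =
    subst₂ _<_ (sym rk-∅) (trans (sym (loopless e)) (cong (rk M) (sym (∪-identityˡ ⁅ e ⁆)))) (ℕ.s≤s ℕ.z≤n)

  ⊤-isFlat : IsFlat M ⊤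
  ⊤-isFlat e e∉⊤ = contradiction ∈⊤ e∉⊤

  nonempty⇒rk>0 : Loopless M → ∀ {X} → Nonempty X → 0 < rk M X
  nonempty⇒rk>0 loopless {X} (e , e∈X) = subst (_≤ rk M X) (loopless e) (rk-mono M e⊆X)
    where
    e⊆X : ⁅ e ⁆ ⊆ X
    e⊆X x∈e = subst (_∈ X) (sym (x∈⁅y⁆⇒x≡y e x∈e)) e∈X

  comparable-flats-rk≡⇒≡ : ∀ {X Y} → IsFlat M X → IsFlat M Y → Comparable X Y → rk M X ≡ rk M Y → X ≡ Y
  comparable-flats-rk≡⇒≡ X-flat Y-flat (inj₁ X⊆Y) rk≡ with ⊆⇒≡⊎⊂ X⊆Y
  ... | inj₁ X≡Y = X≡Y
  ... | inj₂ X⊂Y = contradiction rk≡ (ℕ.<⇒≢ (flat-⊂⇒rk< X-flat X⊂Y))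
  comparable-flats-rk≡⇒≡ X-flat Y-flat (inj₂ Y⊆X) rk≡ with ⊆⇒≡⊎⊂ Y⊆X
  ... | inj₁ Y≡X = sym Y≡X
  ... | inj₂ Y⊂X = contradiction (sym rk≡) (ℕ.<⇒≢ (flat-⊂⇒rk< Y-flat Y⊂X))

  gap-rank-unattained : ∀ {P Q S} {Xs : List (Subset N)} → IsFlat M P → IsFlat M S → P ⊂ S → S ⊂ Q →
    All (λ X → X ⊆ P ⊎ Q ⊆ X) Xs → ¬ Any (λ X → rk M X ≡ rk M S) Xs
  gap-rank-unattained P-flat S-flat P⊂S S⊂Q (inj₁ X⊆P ∷ _) (here rkX≡rkS) =
    ℕ.<⇒≢ (ℕ.≤-<-trans (rk-mono M X⊆P) (flat-⊂⇒rk< P-flat P⊂S)) rkX≡rkS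
  gap-rank-unattained P-flat S-flat P⊂S S⊂Q (inj₂ Q⊆X ∷ _) (here rkX≡rkS) =
    ℕ.<⇒≢ (ℕ.<-≤-trans (flat-⊂⇒rk< S-flat S⊂Q) (rk-mono M Q⊆X)) (sym rkX≡rkS)
  gap-rank-unattained P-flat S-flat P⊂S S⊂Q (_ ∷ sides) (there attained) =
    gap-rank-unattained P-flat S-flat P⊂S S⊂Q sides attained

module _ {N} (M : Matroid N) (loopless : Loopless M) {L : List (Subset N)} (flats : All (IsNPFlat M) L) where

  ends-flat : ∀ {X} → X ∈ₗ ∅ ∷ ⊤ ∷ L → IsFlat M X
  ends-flat (here refl)         = ∅-isFlat M loopless
  ends-flat (there (here refl)) = ⊤-isFlat M
  ends-flat (there (there X∈L)) = proj₁ (All.lookup flats X∈L)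

  crowded-chain-repeats : ∀ {A B} Xs → (∀ {X} → X ∈ₗ Xs → X ∈ₗ L) → IsChain L → A ∈ₗ ∅ ∷ ⊤ ∷ L →
    All (λ X → A ⊂ X × X ⊂ B) Xs → rk M A < rk M B → rk M B ≤ rk M A ℕ.+ length Xs →
    ∃ λ G → ∃ λ Zs → Xs ↭ G ∷ G ∷ Zs
  crowded-chain-repeats {A} {B} Xs Xs⊆L chain A∈ between rkA<rkB crowded
    with pigeonhole (rk M) (rk M B) Xs ranks
           (subst (rk M B ∸ suc (rk M A) <_) (ℕ.m+n∸m≡n (suc (rk M A)) (length Xs)) (ℕ.∸-monoˡ-< (ℕ.s≤s crowded) rkA<rkB))
    where
    ranks : All (λ X → suc (rk M A) ≤ rk M X × rk M X < rk M B) Xs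
    ranks = All.tabulate (λ X∈Xs → let A⊂X , X⊂B = All.lookup between X∈Xs in
      flat-⊂⇒rk< M (ends-flat A∈) A⊂X , flat-⊂⇒rk< M (ends-flat (there (there (Xs⊆L X∈Xs)))) X⊂B)
  ... | X , Y , Zs , Xs↭X∷Y∷Zs , rkX≡rkY = X , Zs , subst (λ Y → Xs ↭ X ∷ Y ∷ Zs) (sym X≡Y) Xs↭X∷Y∷Zs
    where
    X∈L : X ∈ₗ L
    X∈L = Xs⊆L (∈-resp-↭ (↭-sym Xs↭X∷Y∷Zs) (here refl))
    Y∈L : Y ∈ₗ L
    Y∈L = Xs⊆L (∈-resp-↭ (↭-sym Xs↭X∷Y∷Zs) (there (here refl)))
    X≡Y : X ≡ Y
    X≡Y = comparable-flats-rk≡⇒≡ M (ends-flat (there (there X∈L))) (ends-flat (there (there Y∈L)))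
            (chain-comparable chain X∈L (there (there Y∈L))) rkX≡rkY

≤⇒<ᵇ≡false : ∀ {k n} → k ≤ n → (n ℕ.<ᵇ k) ≡ false
≤⇒<ᵇ≡false ℕ.z≤n       = refl
≤⇒<ᵇ≡false (ℕ.s≤s k≤n) = ≤⇒<ᵇ≡false k≤n

≡ᵇ≡true⇒≡ : ∀ m n → (m ℕ.≡ᵇ n) ≡ true → m ≡ n
≡ᵇ≡true⇒≡ m n eq = ℕ.≡ᵇ⇒≡ m n (subst Bool.T (sym eq) _)

γcoef-formula : ∀ {n k} → 1 ≤ k → k ≤ n → ∀ S →
  γcoef n k S ≡ ℕtoℚ (∣ S ∣ ℕ.⊓ k) - ((ℤ.+ k) / suc n) * ℕtoℚ ∣ S ∣
γcoef-formula {n} 1≤k k≤n S = formula 1≤k k≤n ∣ S ∣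
  where
  formula : ∀ {k} → 1 ≤ k → k ≤ n → ∀ s →
    (if (k ℕ.≤ᵇ 0) Bool.∨ (n ℕ.<ᵇ k) Bool.∨ (s ℕ.≡ᵇ 0) Bool.∨ (s ℕ.≡ᵇ suc n) then 0ℚ
     else ℕtoℚ (s ℕ.⊓ k) - (ℤ.+ (k ℕ.* s)) / suc n)
    ≡ ℕtoℚ (s ℕ.⊓ k) - ((ℤ.+ k) / suc n) * ℕtoℚ s
  formula {suc k} _ k≤n zero rewrite ≤⇒<ᵇ≡false k≤n =
    sym (solve 1 (λ q → con 0ℚ :- q :* con 0ℚ := con 0ℚ) refl ((ℤ.+ suc k) / suc n))
    where open ℚ-Solver
  formula {suc k} _ k≤n (suc s) rewrite ≤⇒<ᵇ≡false k≤n with s ℕ.≡ᵇ n in s≡ᵇn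
  ... | true with refl ← ≡ᵇ≡true⇒≡ s n s≡ᵇn = sym (trans
    (cong₂ _-_ (cong ℕtoℚ (ℕ.m≥n⇒m⊓n≡n (ℕ.m≤n⇒m≤1+n k≤n))) ([k/N]*N≡k (suc k) n))
    (+-inverseʳ (ℕtoℚ (suc k))))
  ... | false = cong (λ x → ℕtoℚ (suc s ℕ.⊓ suc k) - x) ([k*s]/N≡[k/N]*s (suc k) (suc s) n)

n<k⇒γcoef≡0 : ∀ {n k} → n < k → ∀ S → γcoef n k S ≡ 0ℚ
n<k⇒γcoef≡0 {n} {k} n<k S rewrite Equivalence.to Bool.T-≡ (ℕ.<⇒<ᵇ n<k) | Bool.∨-zeroʳ (k ℕ.≤ᵇ 0) = refl

restrict : ∀ {N} {P : Subset N → Set} → (∀ T → Dec (P T)) → (Subset N → ℚ) → Subset N → ℚ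
restrict P? c T = if does (P? T) then c T else 0ℚ

-- Coefficients of x_F·γ_k rewritten over the flats below F (for k ≤ |F|, i ∈ F) and above F
-- (for |F| ≤ k, j ∉ F). They come from γ_k = Σ_T min(|T|,k) x_T − k·α, where α = Σ_{T ∋ e} x_T
-- does not depend on e, together with x_F·|F|·α = x_F·Σ_T |T ∩ F| x_T.
lowerCoef : ∀ {N} → Subset N → Fin N → ℕ → Subset N → ℚ
lowerCoef F i k = restrict (_⊂? F) (λ T → ℕtoℚ (∣ T ∣ ℕ.⊓ k) - ℕtoℚ k * 𝟙 (lookup T i))

upperCoef : ∀ {N} → Subset N → Fin N → ℕ → Subset N → ℚ
upperCoef F j k = restrict (F ⊂?_)
  (λ T → ((ℕtoℚ (∣ T ∣ ℕ.⊓ k) - ℕtoℚ k * 𝟙 (lookup T j)) + ℕtoℚ ∣ F ∣ * 𝟙 (lookup T j)) - ℕtoℚ ∣ T ∩ F ∣)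

φ∏ : ∀ {N} → (List (Subset N) → ℚ) → List (Subset N) → List (Subset N → ℚ) → ℚ
φ∏ φ m []       = φ m
φ∏ φ m (c ∷ cs) = ΣS (λ S → c S * φ∏ φ (m ++ S ∷ []) cs)

φγ≡φ∏ : ∀ {n} (φ : List (Subset (suc n)) → ℚ) m ks → φγ φ m ks ≡ φ∏ φ m (map (γcoef n) ks)
φγ≡φ∏ φ m []       = refl
φγ≡φ∏ φ m (k ∷ ks) = ΣS-cong (λ S → cong (γcoef _ k S *_) (φγ≡φ∏ φ (m ++ S ∷ []) ks))

φ∏-vanishes : ∀ {N} {K : Set} {φ : List (Subset N) → ℚ} (c : K → Subset N → ℚ) (P : K → Subset N → Set) →
  (∀ k T → c k T ≡ 0ℚ ⊎ P k T) → ∀ ks m → (∀ Ts → Pointwise P ks Ts → φ (m ++ Ts) ≡ 0ℚ) →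
  φ∏ φ m (map c ks) ≡ 0ℚ
φ∏-vanishes {φ = φ} c P supp []       m vanish = trans (cong φ (sym (++-identityʳ m))) (vanish [] [])
φ∏-vanishes {φ = φ} c P supp (k ∷ ks) m vanish = ΣS-zero term
  where
  term : ∀ S → c k S * φ∏ φ (m ++ S ∷ []) (map c ks) ≡ 0ℚ
  term S with supp k S
  ... | inj₁ c≡0 = trans (cong (_* φ∏ φ (m ++ S ∷ []) (map c ks)) c≡0) (*-zeroˡ (φ∏ φ (m ++ S ∷ []) (map c ks)))
  ... | inj₂ PkS = trans (cong (c k S *_) (φ∏-vanishes c P supp ks (m ++ S ∷ []) vanish′)) (*-zeroʳ (c k S))
    where
    vanish′ : ∀ Ts → Pointwise P ks Ts → φ ((m ++ S ∷ []) ++ Ts) ≡ 0ℚ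
    vanish′ Ts Ts∼ks = trans (cong φ (++-assoc m (S ∷ []) Ts)) (vanish (S ∷ Ts) (PkS ∷ Ts∼ks))

module DegreeFunctional {n r : ℕ} (M : Matroid (suc n)) {φ : List (Subset (suc n)) → ℚ}
                        (isDeg : IsDegFunctional M r φ) where

  open IsDegFunctional isDeg

  IsNPFlat? : (X : Subset (suc n)) → Dec (IsNPFlat M X)
  IsNPFlat? X = all? (λ e → ¬? (e ∈? X) →-dec (rk M X ℕ.<? rk M (X ∪ ⁅ e ⁆)))
                ×-dec nonempty? X ×-dec ¬? (≡-dec Bool._≟_ X ⊤)

  φ-incomparable-vanishes : ∀ {L X Y} → length L ≡ r → All (IsNPFlat M) L → X ∈ₗ L → Y ∈ₗ L → ¬ Comparable X Y →
    φ L ≡ 0ℚ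
  φ-incomparable-vanishes {L} {X} {Y} len flats X∈L Y∈L X≁Y with L′ , L↭XL′ ← ∈⇒↭∷ X∈L | ∈-resp-↭ L↭XL′ Y∈L
  ... | here refl   = contradiction (inj₁ (λ {x} → ⊆-refl {x = X} {x})) X≁Y
  ... | there Y∈L′ with L″ , L′↭YL″ ← ∈⇒↭∷ Y∈L′ =
    trans (symm L↭XYL″)
          (incomp X Y L″ (trans (sym (↭-length L↭XYL″)) len) (All.lookup flats X∈L) (All.lookup flats Y∈L) X≁Y)
    where
    L↭XYL″ : L ↭ X ∷ Y ∷ L″
    L↭XYL″ = ↭-trans L↭XL′ (prep X L′↭YL″)

  φ-vanishes-unless-chain : ∀ L → length L ≡ r → φ L ≡ 0ℚ ⊎ (All (IsNPFlat M) L × IsChain L)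
  φ-vanishes-unless-chain L len with All.all? IsNPFlat? L
  ... | no ¬flats = inj₁ (nonflat L len (¬All⇒Any¬ IsNPFlat? L ¬flats))
  ... | yes flats with All.all? (λ X → All.all? (comparable? X) L) L
  ...   | yes chain = inj₂ (flats , chain)
  ...   | no ¬chain with X , X∈L , ¬X≁L ← find (¬All⇒Any¬ (λ X → All.all? (comparable? X) L) L ¬chain)
                     with Y , Y∈L , X≁Y ← find (¬All⇒Any¬ (comparable? X) L ¬X≁L) =
    inj₁ (φ-incomparable-vanishes len flats X∈L Y∈L X≁Y)

  φ∏-resp-↭ : ∀ {m m′} → m ↭ m′ → ∀ cs → φ∏ φ m cs ≡ φ∏ φ m′ cs
  φ∏-resp-↭ m↭m′ []       = symm m↭m′
  φ∏-resp-↭ m↭m′ (c ∷ cs) = ΣS-cong (λ S → cong (c S *_) (φ∏-resp-↭ (++⁺ʳ (S ∷ []) m↭m′) cs))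

  -- x_F·Σ_T c(T) x_T = x_F·Σ_T c′(T) x_T, tested against every monomial x_ρ of degree r − 2.
  record SameProductWith (F : Subset (suc n)) (c c′ : Subset (suc n) → ℚ) : Set where
    constructor sameProduct
    field
      same : ∀ ρ → suc (suc (length ρ)) ≡ r → ΣS (λ T → c T * φ (T ∷ F ∷ ρ)) ≡ ΣS (λ T → c′ T * φ (T ∷ F ∷ ρ))

  SameProductWith-φ∏ : ∀ {F c c′} → SameProductWith F c c′ → ∀ cs m → suc (suc (length m ℕ.+ length cs)) ≡ r →
    ΣS (λ T → c T * φ∏ φ (T ∷ F ∷ m) cs) ≡ ΣS (λ T → c′ T * φ∏ φ (T ∷ F ∷ m) cs)
  SameProductWith-φ∏ (sameProduct c≈c′) [] m len =
    c≈c′ m (trans (cong (λ l → suc (suc l)) (sym (ℕ.+-identityʳ _))) len)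
  SameProductWith-φ∏ {F} {c} {c′} c≈c′ (d ∷ cs) m len = begin
    ΣS (λ T → c T * ΣS (λ S → d S * φ∏ φ (T ∷ F ∷ m ++ S ∷ []) cs))
      ≡⟨ ΣS-exchange c d _ ⟩
    ΣS (λ S → d S * ΣS (λ T → c T * φ∏ φ (T ∷ F ∷ m ++ S ∷ []) cs))
      ≡⟨ ΣS-cong (λ S → cong (d S *_) (SameProductWith-φ∏ c≈c′ cs (m ++ S ∷ []) (len′ S))) ⟩
    ΣS (λ S → d S * ΣS (λ T → c′ T * φ∏ φ (T ∷ F ∷ m ++ S ∷ []) cs))
      ≡⟨ ΣS-exchange c′ d _ ⟨
    ΣS (λ T → c′ T * ΣS (λ S → d S * φ∏ φ (T ∷ F ∷ m ++ S ∷ []) cs)) ∎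
    where
    open ≡-Reasoning
    len′ : ∀ S → suc (suc (length (m ++ S ∷ []) ℕ.+ length cs)) ≡ r
    len′ S = trans (cong (λ l → suc (suc l)) (length-∷ʳ-+ m S (length cs))) len

  φ∏-replace : ∀ {F cs cs′} → Pointwise (SameProductWith F) cs cs′ → ∀ m → suc (length m ℕ.+ length cs) ≡ r →
    φ∏ φ (F ∷ m) cs ≡ φ∏ φ (F ∷ m) cs′
  φ∏-replace [] m len = refl
  φ∏-replace {F} {c ∷ cs} {c′ ∷ cs′} (c≈c′ ∷ cs≈cs′) m len = begin
    ΣS (λ S → c S * φ∏ φ (F ∷ m ++ S ∷ []) cs)
      ≡⟨ ΣS-cong (λ S → cong (c S *_) (φ∏-replace cs≈cs′ (m ++ S ∷ []) (len′ S))) ⟩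
    ΣS (λ S → c S * φ∏ φ (F ∷ m ++ S ∷ []) cs′)
      ≡⟨ ΣS-cong (λ S → cong (c S *_) (φ∏-resp-↭ (↭-sym (∷↭∷ʳ S (F ∷ m))) cs′)) ⟩
    ΣS (λ S → c S * φ∏ φ (S ∷ F ∷ m) cs′)
      ≡⟨ SameProductWith-φ∏ c≈c′ cs′ m len″ ⟩
    ΣS (λ S → c′ S * φ∏ φ (S ∷ F ∷ m) cs′)
      ≡⟨ ΣS-cong (λ S → cong (c′ S *_) (φ∏-resp-↭ (∷↭∷ʳ S (F ∷ m)) cs′)) ⟩
    ΣS (λ S → c′ S * φ∏ φ (F ∷ m ++ S ∷ []) cs′) ∎
    where
    open ≡-Reasoning
    len′ : ∀ S → suc (length (m ++ S ∷ []) ℕ.+ length cs) ≡ r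
    len′ S = trans (cong suc (length-∷ʳ-+ m S (length cs))) len
    len″ : suc (suc (length m ℕ.+ length cs′)) ≡ r
    len″ = trans (cong (λ l → suc (suc (length m ℕ.+ l))) (sym (Pointwise-length cs≈cs′)))
                 (trans (cong suc (sym (ℕ.+-suc _ _))) len)

  module WeightedBy (F : Subset (suc n)) (F-flat : IsNPFlat M F) (ρ : List (Subset (suc n)))
                    (len : suc (suc (length ρ)) ≡ r) where

    w : Subset (suc n) → ℚ
    w T = φ (T ∷ F ∷ ρ)

    -- ⟪ c ⟫ is deg(x_F·x_ρ·Σ_T c(T) x_T).
    ⟪_⟫ : (Subset (suc n) → ℚ) → ℚ
    ⟪ c ⟫ = ΣS (λ T → c T * w T)

    ⟪⟫-+ : ∀ c d → ⟪ (λ T → c T + d T) ⟫ ≡ ⟪ c ⟫ + ⟪ d ⟫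
    ⟪⟫-+ c d = trans (ΣS-cong (λ T → *-distribʳ-+ (w T) (c T) (d T))) (sumOver-+ (allSubsets (suc n)) _ _)

    ⟪⟫-- : ∀ c d → ⟪ (λ T → c T - d T) ⟫ ≡ ⟪ c ⟫ - ⟪ d ⟫
    ⟪⟫-- c d = trans (ΣS-cong (λ T → solve 3 (λ a b x → (a :- b) :* x := a :* x :- b :* x) refl
                                              (c T) (d T) (w T)))
                     (sumOver-- (allSubsets (suc n)) _ _)
      where open ℚ-Solver

    ⟪⟫-* : ∀ q c → ⟪ (λ T → q * c T) ⟫ ≡ q * ⟪ c ⟫
    ⟪⟫-* q c = trans (ΣS-cong (λ T → *-assoc q (c T) (w T))) (sumOver-*ˡ (allSubsets (suc n)) q _)

    α : Fin (suc n) → ℚ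
    α e = ⟪ (λ T → 𝟙 (lookup T e)) ⟫

    α-constant : ∀ e e′ → α e ≡ α e′
    α-constant e e′ = x∙y⁻¹≈ε⇒x≈y (α e) (α e′) (begin
      α e - α e′                                                        ≡⟨ cong₂ _-_ (as-if e) (as-if e′) ⟩
      ΣS (λ S → if lookup S e then w S else 0ℚ)
        - ΣS (λ S → if lookup S e′ then w S else 0ℚ)                    ≡⟨ linear e e′ (F ∷ ρ) len ⟩
      0ℚ                                                                ∎)
      where
      open ≡-Reasoning
      as-if : ∀ e → α e ≡ ΣS (λ S → if lookup S e then w S else 0ℚ)
      as-if e = ΣS-cong (λ S → 𝟙-* (lookup S e) (w S))

    ⟪∣∩∣⟫ : ∀ X e → ⟪ (λ T → ℕtoℚ ∣ T ∩ X ∣) ⟫ ≡ ℕtoℚ ∣ X ∣ * α e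
    ⟪∣∩∣⟫ X e = begin
      ⟪ (λ T → ℕtoℚ ∣ T ∩ X ∣) ⟫
        ≡⟨ ΣS-cong (λ T → per-element T) ⟩
      ΣS (λ T → sumOver (allFin (suc n)) (λ x → 𝟙 (lookup X x) * (𝟙 (lookup T x) * w T)))
        ≡⟨ sumOver-comm (allSubsets (suc n)) (allFin (suc n)) _ ⟩
      sumOver (allFin (suc n)) (λ x → ΣS (λ T → 𝟙 (lookup X x) * (𝟙 (lookup T x) * w T)))
        ≡⟨ sumOver-cong (allFin (suc n)) (λ x → sumOver-*ˡ (allSubsets (suc n)) (𝟙 (lookup X x)) _) ⟩
      sumOver (allFin (suc n)) (λ x → 𝟙 (lookup X x) * α x)
        ≡⟨ sumOver-cong (allFin (suc n)) (λ x → trans (cong (𝟙 (lookup X x) *_) (α-constant x e)) (*-comm _ (α e))) ⟩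
      sumOver (allFin (suc n)) (λ x → α e * 𝟙 (lookup X x))
        ≡⟨ sumOver-*ˡ (allFin (suc n)) (α e) _ ⟩
      α e * sumOver (allFin (suc n)) (λ x → 𝟙 (lookup X x))
        ≡⟨ trans (*-comm (α e) _) (cong (_* α e) (sym (ℕtoℚ∣S∣≡Σ𝟙 X))) ⟩
      ℕtoℚ ∣ X ∣ * α e ∎
      where
      open ≡-Reasoning
      𝟙-∧ : ∀ a b x → 𝟙 (a Bool.∧ b) * x ≡ 𝟙 b * (𝟙 a * x)
      𝟙-∧ true  true  x = trans (*-identityˡ x) (sym (trans (*-identityˡ _) (*-identityˡ x)))
      𝟙-∧ true  false x = trans (*-zeroˡ x) (sym (*-zeroˡ (1ℚ * x)))
      𝟙-∧ false b     x = trans (*-zeroˡ x) (sym (trans (cong (𝟙 b *_) (*-zeroˡ x)) (*-zeroʳ (𝟙 b))))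
      per-element : ∀ T →
        ℕtoℚ ∣ T ∩ X ∣ * w T ≡ sumOver (allFin (suc n)) (λ x → 𝟙 (lookup X x) * (𝟙 (lookup T x) * w T))
      per-element T = begin
        ℕtoℚ ∣ T ∩ X ∣ * w T
          ≡⟨ trans (cong (_* w T) (ℕtoℚ∣S∣≡Σ𝟙 (T ∩ X))) (*-comm _ (w T)) ⟩
        w T * sumOver (allFin (suc n)) (λ x → 𝟙 (lookup (T ∩ X) x))
          ≡⟨ sumOver-*ˡ (allFin (suc n)) (w T) _ ⟨
        sumOver (allFin (suc n)) (λ x → w T * 𝟙 (lookup (T ∩ X) x))
          ≡⟨ sumOver-cong (allFin (suc n)) (λ x → trans (*-comm (w T) _)
               (trans (cong (λ b → 𝟙 b * w T) (lookup-zipWith Bool._∧_ x T X)) (𝟙-∧ (lookup T x) (lookup X x) (w T)))) ⟩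
        sumOver (allFin (suc n)) (λ x → 𝟙 (lookup X x) * (𝟙 (lookup T x) * w T)) ∎

    w-support : ∀ T → w T ≡ 0ℚ ⊎ Comparable T F
    w-support T with IsNPFlat? T
    ... | no ¬T-flat = inj₁ (nonflat (T ∷ F ∷ ρ) len (here ¬T-flat))
    ... | yes T-flat with comparable? T F
    ...   | no T≁F = inj₁ (incomp T F ρ len T-flat F-flat T≁F)
    ...   | yes T∼F = inj₂ T∼F

    ⟪restrict⟫ : ∀ {P : Subset (suc n) → Set} (P? : ∀ T → Dec (P T)) c →
      (∀ T → w T ≡ 0ℚ ⊎ P T ⊎ c T ≡ 0ℚ) → ⟪ restrict P? c ⟫ ≡ ⟪ c ⟫
    ⟪restrict⟫ P? c cases = ΣS-cong pointwise
      where
      pointwise : ∀ T → restrict P? c T * w T ≡ c T * w T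
      pointwise T with P? T | cases T
      ... | yes _ | _                  = refl
      ... | no _  | inj₁ w≡0           = trans (*-zeroˡ (w T)) (sym (trans (cong (c T *_) w≡0) (*-zeroʳ (c T))))
      ... | no ¬p | inj₂ (inj₁ p)      = contradiction p ¬p
      ... | no _  | inj₂ (inj₂ c≡0)    = cong (_* w T) (sym c≡0)

    ⟪γ⟫ : ∀ {k} → 1 ≤ k → k ≤ n → ∀ e → ⟪ γcoef n k ⟫ ≡ ⟪ (λ T → ℕtoℚ (∣ T ∣ ℕ.⊓ k)) ⟫ - ℕtoℚ k * α e
    ⟪γ⟫ {k} 1≤k k≤n e = begin
      ⟪ γcoef n k ⟫                                     ≡⟨ ΣS-cong (λ T → cong (_* w T) (γcoef-formula 1≤k k≤n T)) ⟩
      ⟪ (λ T → min T - q * ℕtoℚ ∣ T ∣) ⟫                ≡⟨ ⟪⟫-- min (λ T → q * ℕtoℚ ∣ T ∣) ⟩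
      ⟪ min ⟫ - ⟪ (λ T → q * ℕtoℚ ∣ T ∣) ⟫              ≡⟨ cong (⟪ min ⟫ -_) (⟪⟫-* q (λ T → ℕtoℚ ∣ T ∣)) ⟩
      ⟪ min ⟫ - q * ⟪ (λ T → ℕtoℚ ∣ T ∣) ⟫              ≡⟨ cong (λ x → ⟪ min ⟫ - q * x) ⟪∣T∣⟫ ⟩
      ⟪ min ⟫ - q * (ℕtoℚ (suc n) * α e)                ≡⟨ cong (⟪ min ⟫ -_) (trans (sym (*-assoc q _ (α e)))
                                                                                 (cong (_* α e) ([k/N]*N≡k k n))) ⟩
      ⟪ min ⟫ - ℕtoℚ k * α e                            ∎
      where
      open ≡-Reasoning
      q = (ℤ.+ k) / suc n
      min : Subset (suc n) → ℚ
      min T = ℕtoℚ (∣ T ∣ ℕ.⊓ k)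
      ⟪∣T∣⟫ : ⟪ (λ T → ℕtoℚ ∣ T ∣) ⟫ ≡ ℕtoℚ (suc n) * α e
      ⟪∣T∣⟫ = begin
        ⟪ (λ T → ℕtoℚ ∣ T ∣) ⟫          ≡⟨ ΣS-cong (λ T → cong (λ X → ℕtoℚ ∣ X ∣ * w T) (sym (∩-identityʳ T))) ⟩
        ⟪ (λ T → ℕtoℚ ∣ T ∩ ⊤ ∣) ⟫      ≡⟨ ⟪∣∩∣⟫ ⊤ e ⟩
        ℕtoℚ ∣ ⊤ {suc n} ∣ * α e        ≡⟨ cong (λ m → ℕtoℚ m * α e) (∣⊤∣≡n (suc n)) ⟩
        ℕtoℚ (suc n) * α e              ∎

    ⟪γ⟫≡⟪lowerCoef⟫ : ∀ {i k} → i ∈ F → 1 ≤ k → k ≤ ∣ F ∣ → k ≤ n → ⟪ γcoef n k ⟫ ≡ ⟪ lowerCoef F i k ⟫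
    ⟪γ⟫≡⟪lowerCoef⟫ {i} {k} i∈F 1≤k k≤∣F∣ k≤n = begin
      ⟪ γcoef n k ⟫                                         ≡⟨ ⟪γ⟫ 1≤k k≤n i ⟩
      ⟪ min ⟫ - ℕtoℚ k * α i                                ≡⟨ cong (⟪ min ⟫ -_) (⟪⟫-* (ℕtoℚ k) (λ T → 𝟙 (lookup T i))) ⟨
      ⟪ min ⟫ - ⟪ (λ T → ℕtoℚ k * 𝟙 (lookup T i)) ⟫        ≡⟨ ⟪⟫-- min (λ T → ℕtoℚ k * 𝟙 (lookup T i)) ⟨
      ⟪ c ⟫                                                 ≡⟨ ⟪restrict⟫ (_⊂? F) c cases ⟨
      ⟪ lowerCoef F i k ⟫                                   ∎
      where
      open ≡-Reasoning
      min c : Subset (suc n) → ℚ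
      min T = ℕtoℚ (∣ T ∣ ℕ.⊓ k)
      c T = min T - ℕtoℚ k * 𝟙 (lookup T i)
      F⊆T⇒c≡0 : ∀ {T} → F ⊆ T → c T ≡ 0ℚ
      F⊆T⇒c≡0 {T} F⊆T = begin
        ℕtoℚ (∣ T ∣ ℕ.⊓ k) - ℕtoℚ k * 𝟙 (lookup T i)  ≡⟨ cong₂ (λ m b → ℕtoℚ m - ℕtoℚ k * 𝟙 b)
                                                            (ℕ.m≥n⇒m⊓n≡n (ℕ.≤-trans k≤∣F∣ (p⊆q⇒∣p∣≤∣q∣ F⊆T)))
                                                            ([]=⇒lookup (F⊆T i∈F)) ⟩
        ℕtoℚ k - ℕtoℚ k * 1ℚ                           ≡⟨ solve 1 (λ x → x :- x :* con 1ℚ := con 0ℚ) refl (ℕtoℚ k) ⟩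
        0ℚ                                             ∎
        where open ℚ-Solver
      cases : ∀ T → w T ≡ 0ℚ ⊎ T ⊂ F ⊎ c T ≡ 0ℚ
      cases T with w-support T
      ... | inj₁ w≡0        = inj₁ w≡0
      ... | inj₂ (inj₂ F⊆T) = inj₂ (inj₂ (F⊆T⇒c≡0 F⊆T))
      ... | inj₂ (inj₁ T⊆F) with ⊆⇒≡⊎⊂ T⊆F
      ...   | inj₁ refl = inj₂ (inj₂ (F⊆T⇒c≡0 (λ x∈T → x∈T)))
      ...   | inj₂ T⊂F  = inj₂ (inj₁ T⊂F)

    ⟪γ⟫≡⟪upperCoef⟫ : ∀ {j k} → j ∉ F → 1 ≤ k → ∣ F ∣ ≤ k → k ≤ n → ⟪ γcoef n k ⟫ ≡ ⟪ upperCoef F j k ⟫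
    ⟪γ⟫≡⟪upperCoef⟫ {j} {k} j∉F 1≤k ∣F∣≤k k≤n = begin
      ⟪ γcoef n k ⟫                                         ≡⟨ ⟪γ⟫ 1≤k k≤n j ⟩
      ⟪ min ⟫ - ℕtoℚ k * α j                                ≡⟨ solve 3 (λ a b c → a :- b := ((a :- b) :+ c) :- c) refl
                                                                    ⟪ min ⟫ (ℕtoℚ k * α j) (ℕtoℚ ∣ F ∣ * α j) ⟩
      ((⟪ min ⟫ - ℕtoℚ k * α j) + ℕtoℚ ∣ F ∣ * α j)
        - ℕtoℚ ∣ F ∣ * α j                                  ≡⟨ cong₂ (λ x y → ((⟪ min ⟫ - x) + y) - ℕtoℚ ∣ F ∣ * α j)
                                                                     (⟪⟫-* (ℕtoℚ k) 𝟙j) (⟪⟫-* (ℕtoℚ ∣ F ∣) 𝟙j) ⟨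
      ((⟪ min ⟫ - ⟪ k𝟙j ⟫) + ⟪ f𝟙j ⟫) - ℕtoℚ ∣ F ∣ * α j      ≡⟨ cong (((⟪ min ⟫ - ⟪ k𝟙j ⟫) + ⟪ f𝟙j ⟫) -_) (⟪∣∩∣⟫ F j) ⟨
      ((⟪ min ⟫ - ⟪ k𝟙j ⟫) + ⟪ f𝟙j ⟫) - ⟪ ∣∩F∣ ⟫             ≡⟨ cong (λ x → (x + ⟪ f𝟙j ⟫) - ⟪ ∣∩F∣ ⟫) (⟪⟫-- min k𝟙j) ⟨
      (⟪ (λ T → min T - k𝟙j T) ⟫ + ⟪ f𝟙j ⟫) - ⟪ ∣∩F∣ ⟫       ≡⟨ cong (_- ⟪ ∣∩F∣ ⟫) (⟪⟫-+ (λ T → min T - k𝟙j T) f𝟙j) ⟨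
      ⟪ (λ T → (min T - k𝟙j T) + f𝟙j T) ⟫ - ⟪ ∣∩F∣ ⟫         ≡⟨ ⟪⟫-- (λ T → (min T - k𝟙j T) + f𝟙j T) ∣∩F∣ ⟨
      ⟪ c ⟫                                                 ≡⟨ ⟪restrict⟫ (F ⊂?_) c cases ⟨
      ⟪ upperCoef F j k ⟫                                   ∎
      where
      open ≡-Reasoning
      open ℚ-Solver
      min 𝟙j k𝟙j f𝟙j ∣∩F∣ c : Subset (suc n) → ℚ
      min T  = ℕtoℚ (∣ T ∣ ℕ.⊓ k)
      𝟙j T   = 𝟙 (lookup T j)
      k𝟙j T  = ℕtoℚ k * 𝟙j T
      f𝟙j T  = ℕtoℚ ∣ F ∣ * 𝟙j T
      ∣∩F∣ T = ℕtoℚ ∣ T ∩ F ∣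
      c T    = ((min T - k𝟙j T) + f𝟙j T) - ∣∩F∣ T
      T⊆F⇒c≡0 : ∀ {T} → T ⊆ F → c T ≡ 0ℚ
      T⊆F⇒c≡0 {T} T⊆F
        rewrite ℕ.m≤n⇒m⊓n≡m (ℕ.≤-trans (p⊆q⇒∣p∣≤∣q∣ T⊆F) ∣F∣≤k) | ∉⇒lookup≡false T (j∉F ∘ T⊆F) | ⊆⇒∩≡ T⊆F =
        solve 3 (λ x y z → ((x :- y :* con 0ℚ) :+ z :* con 0ℚ) :- x := con 0ℚ) refl (ℕtoℚ ∣ T ∣) (ℕtoℚ k) (ℕtoℚ ∣ F ∣)
      cases : ∀ T → w T ≡ 0ℚ ⊎ F ⊂ T ⊎ c T ≡ 0ℚ
      cases T with w-support T
      ... | inj₁ w≡0        = inj₁ w≡0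
      ... | inj₂ (inj₁ T⊆F) = inj₂ (inj₂ (T⊆F⇒c≡0 T⊆F))
      ... | inj₂ (inj₂ F⊆T) with ⊆⇒≡⊎⊂ F⊆T
      ...   | inj₁ refl = inj₂ (inj₂ (T⊆F⇒c≡0 (λ x∈T → x∈T)))
      ...   | inj₂ F⊂T  = inj₂ (inj₁ F⊂T)

  γ≈lowerCoef : ∀ {F i k} → IsNPFlat M F → i ∈ F → 1 ≤ k → k ≤ ∣ F ∣ → k ≤ n →
    SameProductWith F (γcoef n k) (lowerCoef F i k)
  γ≈lowerCoef F-flat i∈F 1≤k k≤∣F∣ k≤n =
    sameProduct (λ ρ len → WeightedBy.⟪γ⟫≡⟪lowerCoef⟫ _ F-flat ρ len i∈F 1≤k k≤∣F∣ k≤n)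

  γ≈upperCoef : ∀ {F j k} → IsNPFlat M F → j ∉ F → 1 ≤ k → ∣ F ∣ ≤ k → k ≤ n →
    SameProductWith F (γcoef n k) (upperCoef F j k)
  γ≈upperCoef F-flat j∉F 1≤k ∣F∣≤k k≤n =
    sameProduct (λ ρ len → WeightedBy.⟪γ⟫≡⟪upperCoef⟫ _ F-flat ρ len j∉F 1≤k ∣F∣≤k k≤n)

  γ≈0 : ∀ {F k} → n < k → SameProductWith F (γcoef n k) (λ _ → 0ℚ)
  γ≈0 n<k = sameProduct (λ ρ _ → ΣS-cong (λ T → cong (_* _) (n<k⇒γcoef≡0 n<k T)))

  -- Multiply the linear relation Σ_{S ∋ i} x_S = Σ_{S ∋ j} x_S by m. As m is a chain through D, G and U,
  -- x_G occurs only on the left, and any other S occurring on one side only lies in one of the two gaps.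
  gap-reduction : ∀ {G D U i j} m → suc (length m) ≡ r → G ∈ₗ m → D ∈ₗ ∅ ∷ ⊤ ∷ m → U ∈ₗ ∅ ∷ ⊤ ∷ m →
    i ∈ G → i ∉ D → j ∈ U → j ∉ G →
    (∀ S → IsFlat M S → D ⊂ S → S ⊂ G → φ (S ∷ m) ≡ 0ℚ) →
    (∀ S → IsFlat M S → G ⊂ S → S ⊂ U → φ (S ∷ m) ≡ 0ℚ) →
    φ (G ∷ m) ≡ 0ℚ
  gap-reduction {G} {D} {U} {i} {j} m len G∈m D∈ U∈ i∈G i∉D j∈U j∉G below above = begin
    φ (G ∷ m)               ≡⟨ +-identityʳ (φ (G ∷ m)) ⟨
    φ (G ∷ m) - 0ℚ          ≡⟨ cong₂ (λ a b → (if a then φ (G ∷ m) else 0ℚ) - (if b then φ (G ∷ m) else 0ℚ))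
                                     ([]=⇒lookup i∈G) (∉⇒lookup≡false G j∉G) ⟨
    f G - g G               ≡⟨ ΣS-concentrated G (λ S → f S - g S) off-G ⟨
    ΣS (λ S → f S - g S)    ≡⟨ sumOver-- (allSubsets (suc n)) f g ⟩
    ΣS f - ΣS g             ≡⟨ linear i j m len ⟩
    0ℚ                      ∎
    where
    open ≡-Reasoning
    f g : Subset (suc n) → ℚ
    f S = if lookup S i then φ (S ∷ m) else 0ℚ
    g S = if lookup S j then φ (S ∷ m) else 0ℚ

    i∈S∌j : ∀ S → S ≢ G → i ∈ S → j ∉ S → φ (S ∷ m) ≡ 0ℚ
    i∈S∌j S S≢G i∈S j∉S with φ-vanishes-unless-chain (S ∷ m) len
    ... | inj₁ φ≡0 = φ≡0
    ... | inj₂ (flats , chain) with chain-comparable chain (here refl) (there (there (there G∈m)))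
    ...   | inj₁ S⊆G with ⊆⇒≡⊎⊂ S⊆G | chain-comparable chain (here refl) (ends-map there D∈)
    ...     | inj₁ S≡G | _        = contradiction S≡G S≢G
    ...     | inj₂ _   | inj₁ S⊆D = contradiction (S⊆D i∈S) i∉D
    ...     | inj₂ S⊂G | inj₂ D⊆S = below S (proj₁ (All.head flats)) ((λ {x} → D⊆S {x}) , i , i∈S , i∉D) S⊂G
    i∈S∌j S S≢G i∈S j∉S | inj₂ (flats , chain) | inj₂ G⊆S
      with ⊆⇒≡⊎⊂ G⊆S | chain-comparable chain (here refl) (ends-map there U∈)
    ...     | inj₁ G≡S | _        = contradiction (sym G≡S) S≢G
    ...     | inj₂ _   | inj₂ U⊆S = contradiction (U⊆S j∈U) j∉S
    ...     | inj₂ G⊂S | inj₁ S⊆U = above S (proj₁ (All.head flats)) G⊂S ((λ {x} → S⊆U {x}) , j , j∈U , j∉S)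

    i∉S∋j : ∀ S → i ∉ S → j ∈ S → φ (S ∷ m) ≡ 0ℚ
    i∉S∋j S i∉S j∈S with φ-vanishes-unless-chain (S ∷ m) len
    ... | inj₁ φ≡0 = φ≡0
    ... | inj₂ (_ , chain) with chain-comparable chain (here refl) (there (there (there G∈m)))
    ...   | inj₁ S⊆G = contradiction (S⊆G j∈S) j∉G
    ...   | inj₂ G⊆S = contradiction (G⊆S i∈G) i∉S

    off-G : ∀ S → S ≢ G → f S - g S ≡ 0ℚ
    off-G S S≢G = if-difference≡0 (lookup S i) (lookup S j) (φ (S ∷ m))
      (λ S[i] S[j] → i∈S∌j S S≢G (lookup⇒[]= i S S[i]) (lookup≡false⇒∉ S[j]))
      (λ S[i] S[j] → i∉S∋j S (lookup≡false⇒∉ S[i]) (lookup⇒[]= j S S[j]))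

  -- A crowded chain repeats some G, and gap-reduction trades one copy of G for a flat whose rank no
  -- member of Xs has, so the number of ranks below rk B missing from Xs decreases.
  crowded-chain-vanishes : Loopless M → ∀ μ {A B} Xs Ys → missingBelow (rk M) (rk M B) Xs < μ →
    length (Xs ++ Ys) ≡ r → A ∈ₗ ∅ ∷ ⊤ ∷ Ys → B ∈ₗ ∅ ∷ ⊤ ∷ Ys → All (λ X → A ⊂ X × X ⊂ B) Xs →
    rk M A < rk M B → rk M B ≤ rk M A ℕ.+ length Xs → φ (Xs ++ Ys) ≡ 0ℚ
  crowded-chain-vanishes loopless zero    Xs Ys () len A∈ B∈ between rkA<rkB crowded
  crowded-chain-vanishes loopless (suc μ) Xs Ys fuel len A∈ B∈ between rkA<rkB crowded
    with φ-vanishes-unless-chain (Xs ++ Ys) len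
  ... | inj₁ φ≡0 = φ≡0
  ... | inj₂ (flats , chain)
    with crowded-chain-repeats M loopless flats Xs ∈-++⁺ˡ chain (ends-map (∈-++⁺ʳ Xs) A∈) between rkA<rkB crowded
  crowded-chain-vanishes loopless (suc μ) {A} {B} Xs Ys fuel len A∈ B∈ between rkA<rkB crowded
    | inj₂ (flats , chain) | G , Zs , Xs↭G∷G∷Zs
    with All-resp-↭ Xs↭G∷G∷Zs between | ∈-++⁺ˡ {ys = Ys} (∈-resp-↭ (↭-sym Xs↭G∷G∷Zs) (here refl))
  ... | (A⊂G , G⊂B) ∷ others | G∈L
    with greatest-below chain Xs ∈-++⁺ˡ G∈L (ends-map (∈-++⁺ʳ Xs) A∈) A⊂G
       | least-above chain Xs ∈-++⁺ˡ G∈L (ends-map (∈-++⁺ʳ Xs) B∈) G⊂B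
  ... | D , A⊆D , D⊂G@(_ , i , i∈G , i∉D) , D∈ , D-sides | U , U⊆B , G⊂U@(_ , j , j∈U , j∉G) , U∈ , U-sides =
    trans (symm L↭G∷m)
      (gap-reduction m len′ (here refl) (ends-map L⊆m D∈) (ends-map L⊆m U∈) i∈G i∉D j∈U j∉G
        (λ S S-flat D⊂S S⊂G → replace S S-flat (⊆-⊂-trans A⊆D D⊂S) (⊂-trans S⊂G G⊂B)
                                (gap-rank-unattained M (ends-flat M loopless flats D∈) S-flat D⊂S S⊂G D-sides))
        (λ S S-flat G⊂S S⊂U → replace S S-flat (⊂-trans A⊂G G⊂S) (⊂-⊆-trans S⊂U U⊆B)
                                (gap-rank-unattained M (proj₁ (All.lookup flats G∈L)) S-flat G⊂S S⊂U U-sides)))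
    where
    m = G ∷ Zs ++ Ys
    L↭G∷m : Xs ++ Ys ↭ G ∷ m
    L↭G∷m = ++⁺ʳ Ys Xs↭G∷G∷Zs
    len′ : suc (length m) ≡ r
    len′ = trans (sym (↭-length L↭G∷m)) len
    L⊆m : ∀ {X} → X ∈ₗ Xs ++ Ys → X ∈ₗ m
    L⊆m X∈L with ∈-resp-↭ L↭G∷m X∈L
    ... | here X≡G  = here X≡G
    ... | there X∈m = X∈m

    replace : ∀ S → IsFlat M S → A ⊂ S → S ⊂ B → ¬ Any (λ X → rk M X ≡ rk M S) Xs → φ (S ∷ m) ≡ 0ℚ
    replace S S-flat A⊂S S⊂B new =
      crowded-chain-vanishes loopless μ (S ∷ G ∷ Zs) Ys fuel′ len′ A∈ B∈ ((A⊂S , S⊂B) ∷ others) rkA<rkB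
        (subst (λ l → rk M B ≤ rk M A ℕ.+ l) (↭-length Xs↭G∷G∷Zs) crowded)
      where
      kept : ∀ {t} → Any (λ X → rk M X ≡ t) Xs → Any (λ X → rk M X ≡ t) (S ∷ G ∷ Zs)
      kept attained with Any-resp-↭ Xs↭G∷G∷Zs attained
      ... | here rkG≡t = there (here rkG≡t)
      ... | there rest = there rest
      fuel′ : missingBelow (rk M) (rk M B) (S ∷ G ∷ Zs) < μ
      fuel′ = ℕ.<-≤-trans (missingBelow-< (rk M) Xs (S ∷ G ∷ Zs) kept (flat-⊂⇒rk< M S-flat S⊂B) (here refl) new)
                          (ℕ.s≤s⁻¹ fuel)

  below-above-vanishes : Loopless M → rk M ⊤ ≡ suc r → ∀ {F} → IsNPFlat M F → ∀ {Ts} lows ups → Ts ↭ lows ++ ups →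
    All (_⊂ F) lows → All (F ⊂_) ups → All (IsNPFlat M) Ts → length (F ∷ Ts) ≡ r → suc (length lows) ≢ rk M F →
    φ (F ∷ Ts) ≡ 0ℚ
  below-above-vanishes loopless rk⊤ {F} F-flat lows ups Ts↭ lows⊂F F⊂ups flats len misses
    with ℕ.<-cmp (suc (length lows)) (rk M F) | All++⁻ lows (All-resp-↭ Ts↭ flats)
  ... | tri≈ _ hit _ | _ = contradiction hit misses
  ... | tri> _ _ rkF≤#lows | lows-flat , _ =
    trans (symm F∷Ts↭) (crowded-chain-vanishes loopless (suc _) lows (F ∷ ups) ℕ.≤-refl
      (trans (sym (↭-length F∷Ts↭)) len) (here refl) (there (there (here refl)))
      (All.zipWith (λ { ((_ , X-nonempty , _) , X⊂F) → nonempty⇒∅⊂ X-nonempty , X⊂F }) (lows-flat , lows⊂F))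
      (subst (_< rk M F) (sym (rk-∅ M)) (nonempty⇒rk>0 M loopless (proj₁ (proj₂ F-flat))))
      (subst (λ z → rk M F ≤ z ℕ.+ length lows) (sym (rk-∅ M)) (ℕ.s≤s⁻¹ rkF≤#lows)))
    where
    F∷Ts↭ : F ∷ _ ↭ lows ++ F ∷ ups
    F∷Ts↭ = ↭-trans (prep F Ts↭) (↭-sym (shift F lows ups))
  ... | tri< #lows<rkF _ _ | _ , ups-flat =
    trans (symm F∷Ts↭) (crowded-chain-vanishes loopless (suc _) ups (F ∷ lows) ℕ.≤-refl
      (trans (sym (↭-length F∷Ts↭)) len) (there (there (here refl))) (there (here refl))
      (All.zipWith (λ { (F⊂X , (_ , _ , X≢⊤)) → F⊂X , ≢⊤⇒⊂⊤ X≢⊤ }) (F⊂ups , ups-flat))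
      (flat-⊂⇒rk< M (proj₁ F-flat) (≢⊤⇒⊂⊤ (proj₂ (proj₂ F-flat))))
      (subst (_≤ rk M F ℕ.+ length ups) (sym rk⊤≡) (ℕ.+-monoˡ-≤ (length ups) #lows<rkF)))
    where
    rk⊤≡ : rk M ⊤ ≡ suc (suc (length lows)) ℕ.+ length ups
    rk⊤≡ = trans rk⊤ (cong suc (trans (sym len) (cong suc (trans (↭-length Ts↭) (length-++ lows)))))
    F∷Ts↭ : F ∷ _ ↭ ups ++ F ∷ lows
    F∷Ts↭ = ↭-trans (prep F (↭-trans Ts↭ (++-comm lows ups))) (↭-sym (shift F ups lows))

  module _ (loopless : Loopless M) (rk⊤ : rk M ⊤ ≡ suc r) {F} (F-flat : IsNPFlat M F)
           {i j} (i∈F : i ∈ F) (j∉F : j ∉ F) {Low : ℕ → Set} (Low? : ∀ k → Dec (Low k))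
           (low≤ : ∀ {k} → Low k → k ≤ ∣ F ∣) (high≥ : ∀ {k} → ¬ Low k → ∣ F ∣ ≤ k) where

    Side : ℕ → Subset (suc n) → Set
    Side k T = (Low k × T ⊂ F) ⊎ (¬ Low k × F ⊂ T)

    representative : ℕ → Subset (suc n) → ℚ
    representative k with n ℕ.<? k | Low? k
    ... | yes _ | _     = λ _ → 0ℚ
    ... | no _  | yes _ = lowerCoef F i k
    ... | no _  | no _  = upperCoef F j k

    representative-support : ∀ k T → representative k T ≡ 0ℚ ⊎ Side k T
    representative-support k T with n ℕ.<? k | Low? k
    ... | yes _ | _ = inj₁ refl
    ... | no _  | yes low with T ⊂? F
    ...   | yes T⊂F = inj₂ (inj₁ (low , T⊂F))
    ...   | no _    = inj₁ refl
    representative-support k T | no _ | no high with F ⊂? T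
    ...   | yes F⊂T = inj₂ (inj₂ (high , F⊂T))
    ...   | no _    = inj₁ refl

    γ≈representative : ∀ {k} → 1 ≤ k → SameProductWith F (γcoef n k) (representative k)
    γ≈representative {k} 1≤k with n ℕ.<? k | Low? k
    ... | yes n<k | _        = γ≈0 n<k
    ... | no n≮k  | yes low  = γ≈lowerCoef F-flat i∈F 1≤k (low≤ low) (ℕ.≮⇒≥ n≮k)
    ... | no n≮k  | no high  = γ≈upperCoef F-flat j∉F 1≤k (high≥ high) (ℕ.≮⇒≥ n≮k)

    record SideSplit (ks : List ℕ) (Ts : List (Subset (suc n))) : Set where
      field
        lows ups : List (Subset (suc n))
        Ts↭lows++ups : Ts ↭ lows ++ ups
        lows⊂F : All (_⊂ F) lows
        F⊂ups : All (F ⊂_) ups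
        #lows : length lows ≡ length (filter Low? ks)

    split-sides : ∀ {ks Ts} → Pointwise Side ks Ts → SideSplit ks Ts
    split-sides [] = record { lows = [] ; ups = [] ; Ts↭lows++ups = ↭-refl ; lows⊂F = [] ; F⊂ups = [] ; #lows = refl }
    split-sides {k ∷ ks} {T ∷ Ts} (inj₁ (low , T⊂F) ∷ sides) = let open SideSplit (split-sides sides) in record
      { lows = T ∷ lows ; ups = ups ; Ts↭lows++ups = prep T Ts↭lows++ups ; lows⊂F = T⊂F ∷ lows⊂F ; F⊂ups = F⊂ups
      ; #lows = trans (cong suc #lows) (sym (cong length (filter-accept Low? low))) }
    split-sides {k ∷ ks} {T ∷ Ts} (inj₂ (high , F⊂T) ∷ sides) = let open SideSplit (split-sides sides) in record
      { lows = lows ; ups = T ∷ ups ; Ts↭lows++ups = ↭-trans (prep T Ts↭lows++ups) (↭-sym (shift T lows ups))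
      ; lows⊂F = lows⊂F ; F⊂ups = F⊂T ∷ F⊂ups ; #lows = trans #lows (sym (cong length (filter-reject Low? high))) }

    sides-vanish : ∀ {ks Ts} → length (F ∷ Ts) ≡ r → suc (length (filter Low? ks)) ≢ rk M F →
      Pointwise Side ks Ts → φ (F ∷ Ts) ≡ 0ℚ
    sides-vanish {Ts = Ts} len misses sides with φ-vanishes-unless-chain (F ∷ Ts) len
    ... | inj₁ φ≡0 = φ≡0
    ... | inj₂ (_ ∷ Ts-flat , _) =
      below-above-vanishes loopless rk⊤ F-flat lows ups Ts↭lows++ups lows⊂F F⊂ups Ts-flat len
        (misses ∘ trans (cong suc (sym #lows)))
      where open SideSplit (split-sides sides)

    φγ-vanishes : ∀ ks → All (1 ≤_) ks → suc (length ks) ≡ r → suc (length (filter Low? ks)) ≢ rk M F →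
      φγ φ (F ∷ []) ks ≡ 0ℚ
    φγ-vanishes ks ks≥1 len misses = begin
      φγ φ (F ∷ []) ks                        ≡⟨ φγ≡φ∏ φ (F ∷ []) ks ⟩
      φ∏ φ (F ∷ []) (map (γcoef n) ks)        ≡⟨ φ∏-replace (representatives ks≥1) []
                                                              (trans (cong suc (length-map (γcoef n) ks)) len) ⟩
      φ∏ φ (F ∷ []) (map representative ks)   ≡⟨ φ∏-vanishes representative Side representative-support ks (F ∷ [])
                                                                 monomials-vanish ⟩
      0ℚ                                      ∎
      where
      open ≡-Reasoning
      representatives : ∀ {ks} → All (1 ≤_) ks →
        Pointwise (SameProductWith F) (map (γcoef n) ks) (map representative ks)
      representatives []            = []
      representatives (1≤k ∷ ks≥1) = γ≈representative 1≤k ∷ representatives ks≥1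
      monomials-vanish : ∀ Ts → Pointwise Side ks Ts → φ (F ∷ Ts) ≡ 0ℚ
      monomials-vanish Ts sides = sides-vanish (trans (cong suc (sym (Pointwise-length sides))) len) misses sides

lemma3p3 : (n r : ℕ) (M : Matroid (suc n)) → Loopless M → rk M ⊤ ≡ suc r →
  (F : Subset (suc n)) → IsNPFlat M F →
  (v : Vec ℕ (r ∸ 1)) → All (λ k → 1 ≤ k) (toList v) → FlatlyContiguous M v →
  rk M F ≢ 1 → rk M F ≢ r →
  (φ : List (Subset (suc n)) → ℚ) → IsDegFunctional M r φ →
  φγ φ (F ∷ []) (toList v) ≡ 0ℚ
lemma3p3 n r M loopless rk⊤ F F-flat@(F-isFlat , F-nonempty , F≢⊤) v v≥1 (_ , _ , _ , _ , in-range , contiguous)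
         rkF≢1 rkF≢r φ isDeg =
  [ φγ-vanishes loopless rk⊤ F-flat i∈F j∉F (_≤? ∣ F ∣) (λ k≤f → k≤f) (ℕ.<⇒≤ ∘ ℕ.≰⇒>) ks v≥1 len
  , φγ-vanishes loopless rk⊤ F-flat i∈F j∉F (_<? ∣ F ∣) ℕ.<⇒≤ ℕ.≮⇒≥ ks v≥1 len
  ] (threshold-count-misses ks in-range (contiguous F F-isFlat) rkF≢1 (λ rkF≡1+len → rkF≢r (trans rkF≡1+len len)))
  where
  open DegreeFunctional M isDeg
  ks = toList v
  i∈F = proj₂ F-nonempty
  j∉F = proj₂ (≢⊤⇒∃∉ F≢⊤)
  1≤r : 1 ≤ r
  1≤r = ℕ.≤-trans (nonempty⇒rk>0 M loopless F-nonempty)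
                  (ℕ.s≤s⁻¹ (subst (rk M F <_) rk⊤ (flat-⊂⇒rk< M F-isFlat (≢⊤⇒⊂⊤ F≢⊤))))
  len : suc (length ks) ≡ r
  len = trans (cong suc (length-toList v)) (ℕ.m+[n∸m]≡n 1≤r)
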